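{- There is a polynomial $P$ such that for every $D\ge 1$, every constraint graph sequence $\xi$ of $D$-VASSes and all $\mathbf{a},\mathbf{b}\in\mathbb{N}^D$, every $\mathbf{m}\in\mathcal{H}(\mathcal{E}_{\mathbf{a}\xi\mathbf{b}})\cup\mathcal{H}(\mathcal{E}^0_{\mathbf{a}\xi\mathbf{b}})$ satisfies $\|\mathbf{m}\|_1\le 2^{P(|\mathbf{a}\xi\mathbf{b}|)}$.
   Context: A $D$-VASS is a finite directed graph $G=(Q,T)$ (multi-edges, self-loops allowed) with edges $p\xrightarrow{\mathbf{t}}q$ labeled by $\mathbf{t}\in\mathbb{Z}^D$. A constraint graph (CG) is a triple $pGq$ with $G$ strongly connected and $p,q$ states of $G$ (possibly $G$ is a single state with no edges, $p=q$). A constraint graph sequence (CGS) is $\xi=\xi_0\xrightarrow{\mathbf{t}_1}\xi_1\cdots\xrightarrow{\mathbf{t}_k}\xi_k$ with $\xi_j=p_jG_jq_j$, $G_j=(Q_j,T_j)$ strongly connected, and connecting edges $q_{j-1}\xrightarrow{\mathbf{t}_j}p_j$, $\mathbf{t}_j\in\mathbb{Z}^D$. To each $\xi_j$ attach fresh variable vectors $\mathbf{x}_j,\mathbf{y}_j$ (length $D$) and variables $\Psi_j(e)$ for $e\in T_j$; write $\Delta(\Psi_j)=\sum_{e=(p',\mathbf{t},q')\in T_j}\Psi_j(e)\mathbf{t}$ and let $\mathbf{1}_o\in\mathbb{Z}^{Q_j}$ be the indicator vector of state $o$. The characteristic system $\mathcal{E}_{\mathbf{a}\xi\mathbf{b}}$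 consists of: for each $j\in\{0,\dots,k\}$, $\sum_{e=(p',\mathbf{t},q')\in T_j}\Psi_j(e)(\mathbf{1}_{q'}-\mathbf{1}_{p'})=\mathbf{1}_{q_j}-\mathbf{1}_{p_j}$, $\Psi_j(e)>0$ for every $e\in T_j$, and $\mathbf{x}_j+\Delta(\Psi_j)=\mathbf{y}_j$; for each $j\in[k]$, $\mathbf{y}_{j-1}+\mathbf{t}_j=\mathbf{x}_j$; and $\mathbf{x}_0=\mathbf{a}$, $\mathbf{y}_k=\mathbf{b}$. Its solutions are assignments of nonnegative integers to all variables satisfying these; $\mathcal{H}(\mathcal{E}_{\mathbf{a}\xi\mathbf{b}})$ is the set of solutions minimal for the pointwise order. The homogeneous system $\mathcal{E}^0_{\mathbf{a}\xi\mathbf{b}}$ consists of $\mathbf{x}_0=\mathbf{0}$, $\mathbf{y}_k=\mathbf{0}$, and for all $j$: $\sum_{e}\Psi_j(e)(\mathbf{1}_{q'}-\mathbf{1}_{p'})=\mathbf{0}$, $\mathbf{x}_j+\Delta(\Psi_j)=\mathbf{y}_j$, $\mathbf{y}_{j-1}=\mathbf{x}_j$; its solutions are nontrivial (not identically zero) nonnegative integer assignments, and $\mathcal{H}(\mathcal{E}^0_{\mathbf{a}\xi\mathbf{b}})$ is the set of pointwise-minimal ones. $\|\mathbf{m}\|_1$ is the sum of all values assigned by $\mathbf{m}$. The size is $|\mathbf{a}\xi\mathbf{b}|=|\mathbf{a}|+|\xi|+|\mathbf{b}|$, where $|\mathbf{a}|=\sum_i|\mathbf{a}(i)|$ and $|\xi|$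 is the size of the binary encoding of the graph of $\xi$ with its labels. -}

module Defs where

open import Data.Nat as ℕ using (ℕ; zero; suc; _≤_; _^_)
open import Data.Nat.Logarithm using (⌊log₂_⌋)
open import Data.Integer as ℤ using (ℤ; +_; ∣_∣)
open import Data.Fin using (Fin; zero; suc; inject₁; fromℕ; _≟_)
open import Data.Bool using (if_then_else_)
open import Data.List using (List; []; _∷_)
open import Data.Product using (Σ; ∃; _×_; _,_)
open import Relation.Nullary.Decidable using (⌊_⌋)
open import Relation.Binary.PropositionalEquality using (_≡_)
open import Relation.Binary.Construct.Closure.ReflexiveTransitive using (Star)

Σℕ : (n : ℕ) → (Fin n → ℕ) → ℕ
Σℕ zero    f = 0
Σℕ (suc n) f = f zero ℕ.+ Σℕ n (λ i → f (suc i))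

Σℤ : (n : ℕ) → (Fin n → ℤ) → ℤ
Σℤ zero    f = + 0
Σℤ (suc n) f = f zero ℤ.+ Σℤ n (λ i → f (suc i))

𝟏 : {n : ℕ} → Fin n → Fin n → ℤ
𝟏 o s = if ⌊ o ≟ s ⌋ then + 1 else + 0

-- Polynomials with natural coefficients (coefficient list, constant first)

evalPoly : List ℕ → ℕ → ℕ
evalPoly []       n = 0
evalPoly (c ∷ cs) n = c ℕ.+ n ℕ.* evalPoly cs n

record VASS (D : ℕ) : Set where
  field
    nQ  : ℕ
    nT  : ℕ
    src : Fin nT → Fin nQ
    tgt : Fin nT → Fin nQ
    lab : Fin nT → Fin D → ℤ
open VASS public

Step : ∀ {D} (G : VASS D) → Fin (nQ G) → Fin (nQ G) → Set
Step G p q = ∃ λ e → src G e ≡ p × tgt G e ≡ q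

StronglyConnected : ∀ {D} → VASS D → Set
StronglyConnected G = ∀ p q → Star (Step G) p q

record CG (D : ℕ) : Set where
  field
    G    : VASS D
    scc  : StronglyConnected G
    p q  : Fin (nQ G)
open CG public

-- constraint graph sequence ξ₀ -t₁→ ξ₁ ⋯ -t_k→ ξ_k
record CGS (D : ℕ) : Set where
  field
    k    : ℕ
    comp : Fin (suc k) → CG D
    conn : Fin k → Fin D → ℤ             -- conn j = t_{j+1}, from q_j to p_{j+1}
open CGS public

nT' : ∀ {D} (ξ : CGS D) → Fin (suc (k ξ)) → ℕ
nT' ξ j = nT (G (comp ξ j))

record Assign {D : ℕ} (ξ : CGS D) : Set where
  field
    x y : Fin (suc (k ξ)) → Fin D → ℕ
    Ψ   : (j : Fin (suc (k ξ))) → Fin (nT' ξ j) → ℕ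
open Assign public

_≼_ : ∀ {D} {ξ : CGS D} → Assign ξ → Assign ξ → Set
_≼_ {ξ = ξ} m m' =
  (∀ j i → x m j i ≤ x m' j i) ×
  (∀ j i → y m j i ≤ y m' j i) ×
  (∀ j e → Ψ m j e ≤ Ψ m' j e)

norm1 : ∀ {D} {ξ : CGS D} → Assign ξ → ℕ
norm1 {D} {ξ} m =
  Σℕ (suc (k ξ)) λ j →
    Σℕ D (x m j) ℕ.+ Σℕ D (y m j) ℕ.+ Σℕ (nT' ξ j) (Ψ m j)

Δ : ∀ {D} (ξ : CGS D) → Assign ξ → Fin (suc (k ξ)) → Fin D → ℤ
Δ ξ m j i = Σℤ (nT' ξ j) λ e → + (Ψ m j e) ℤ.* lab (G (comp ξ j)) e i

flow : ∀ {D} (ξ : CGS D) → Assign ξ → (j : Fin (suc (k ξ))) →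
       Fin (nQ (G (comp ξ j))) → ℤ
flow ξ m j o = Σℤ (nT' ξ j) λ e →
  + (Ψ m j e) ℤ.* (𝟏 (tgt (G (comp ξ j)) e) o ℤ.- 𝟏 (src (G (comp ξ j)) e) o)

record Sol {D : ℕ} (a : Fin D → ℕ) (ξ : CGS D) (b : Fin D → ℕ)
           (m : Assign ξ) : Set where
  field
    kirchhoff : ∀ j o → flow ξ m j o ≡
                  𝟏 (q (comp ξ j)) o ℤ.- 𝟏 (p (comp ξ j)) o
    positive  : ∀ j e → 0 ℕ.< Ψ m j e
    effect    : ∀ j i → + (x m j i) ℤ.+ Δ ξ m j i ≡ + (y m j i)
    connect   : ∀ (j : Fin (k ξ)) i →
                  + (y m (inject₁ j) i) ℤ.+ conn ξ j i ≡ + (x m (suc j) i)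
    start     : ∀ i → x m zero i ≡ a i
    end       : ∀ i → y m (fromℕ (k ξ)) i ≡ b i

record Sol0 {D : ℕ} (a : Fin D → ℕ) (ξ : CGS D) (b : Fin D → ℕ)
            (m : Assign ξ) : Set where
  field
    kirchhoff  : ∀ j o → flow ξ m j o ≡ + 0
    effect     : ∀ j i → + (x m j i) ℤ.+ Δ ξ m j i ≡ + (y m j i)
    connect    : ∀ (j : Fin (k ξ)) i → y m (inject₁ j) i ≡ x m (suc j) i
    start      : ∀ i → x m zero i ≡ 0
    end        : ∀ i → y m (fromℕ (k ξ)) i ≡ 0
    nontrivial : 0 ℕ.< norm1 m

Minimal : ∀ {D} {ξ : CGS D} → (Assign ξ → Set) → Assign ξ → Set
Minimal {ξ = ξ} S m = S m × (∀ (m' : Assign ξ) → S m' → m' ≼ m → m ≼ m')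

-- binary encoding size of an integer: sign bit + binary digits of |z|
bitsℤ : ℤ → ℕ
bitsℤ z = 2 ℕ.+ ⌊log₂ ∣ z ∣ ⌋

sizeVec : ∀ {D} → (Fin D → ℤ) → ℕ
sizeVec {D} v = Σℕ D (λ i → bitsℤ (v i))

sizeVASS : ∀ {D} → VASS D → ℕ
sizeVASS G = nQ G ℕ.+ Σℕ (nT G) (λ e → 1 ℕ.+ sizeVec (lab G e))

sizeCGS : ∀ {D} → CGS D → ℕ
sizeCGS ξ = Σℕ (suc (k ξ)) (λ j → sizeVASS (G (comp ξ j)))
          ℕ.+ Σℕ (k ξ) (λ j → 1 ℕ.+ sizeVec (conn ξ j))

sizeℕvec : ∀ {D} → (Fin D → ℕ) → ℕ
sizeℕvec {D} a = Σℕ D a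

size : ∀ {D} → (Fin D → ℕ) → CGS D → (Fin D → ℕ) → ℕ
size a ξ b = sizeℕvec a ℕ.+ sizeCGS ξ ℕ.+ sizeℕvec b

module Submission where

-- Write the characteristic system as one integer linear equation per row and split a solution m
-- into ‖m‖₁ unit tokens, each contributing a column of norm at most 2Λ, Λ bounding the labels.
-- By the Steinitz lemma the columns can be ordered so that all partial sums are small; if there
-- are more tokens than small integer vectors, two partial sums coincide, so a nonempty block of
-- tokens sums to zero.  Removing that block (or, for the homogeneous system, keeping only it)
-- gives a smaller solution, contradicting minimality.  All bounds involved are exponential in the
-- size of the input.
--
-- The Steinitz lemma is proved following Grinberg and Sevastyanov, building the order from the
-- back.  The n vectors not yet placed carry weights λ ∈ [0,1] with Σ λ = n − d and Σ λ v = 0, so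
-- their sum, the prefix of length n, is Σ (1 − λ) v and has norm at most d δ.  Moving the weights
-- to a vertex of the polytope cut out by these constraints leaves at most d + 1 of them
-- fractional, which forces a zero weight; that vector is placed last.

open import Data.Nat as ℕ using (ℕ)
open import Data.Integer as ℤ using (ℤ)
open import Data.Rational using (ℚ)
open import Data.List using (List)
open import Defs using (CGS; G; comp; lab)

module RationalFacts where
  open import Data.Rational using (ℚ; 0ℚ; 1ℚ; _+_; _*_; _-_; _≤_; _<_; ∣_∣; *≤*; NonZero; 1/_; _÷_)
  open import Data.Rational using (nonNegative; nonPositive; positive)
  open import Data.Rational.Literals using (fromℤ)
  import Data.Rational.Properties as ℚ
  import Data.Rational.Unnormalised as ℚᵘ
  import Data.Rational.Unnormalised.Properties as ℚᵘ
  open import Data.Rational.Solver using (module +-*-Solver)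
  open import Data.Integer as ℤ using (ℤ; -[1+_])
  import Data.Integer.Properties as ℤ
  open import Data.Nat as ℕ using (ℕ; zero; suc; z≤n)
  import Data.Nat.Properties as ℕ
  open import Data.Product using (_×_; _,_)
  open import Relation.Binary.PropositionalEquality

  fromℤ-+ : ∀ i j → fromℤ (i ℤ.+ j) ≡ fromℤ i + fromℤ j
  fromℤ-+ i j = ℚ.toℚᵘ-injective (ℚᵘ.≃-trans
    (ℚᵘ.*≡* (cong₂ ℤ._*_ (cong₂ ℤ._+_ (sym (ℤ.*-identityʳ i)) (sym (ℤ.*-identityʳ j))) refl))
    (ℚᵘ.≃-sym (ℚ.toℚᵘ-homo-+ (fromℤ i) (fromℤ j))))

  fromℤ-mono-≤ : ∀ {i j} → i ℤ.≤ j → fromℤ i ≤ fromℤ j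
  fromℤ-mono-≤ {i} {j} i≤j = *≤* (subst₂ ℤ._≤_ (sym (ℤ.*-identityʳ i)) (sym (ℤ.*-identityʳ j)) i≤j)

  fromℤ-cancel-≤ : ∀ {i j} → fromℤ i ≤ fromℤ j → i ℤ.≤ j
  fromℤ-cancel-≤ {i} {j} (*≤* i≤j) = subst₂ ℤ._≤_ (ℤ.*-identityʳ i) (ℤ.*-identityʳ j) i≤j

  ∣fromℤ∣ : ∀ i → ∣ fromℤ i ∣ ≡ fromℤ (ℤ.+ ℤ.∣ i ∣)
  ∣fromℤ∣ (ℤ.+ n)  = refl
  ∣fromℤ∣ -[1+ n ] = refl

  fromℕ : ℕ → ℚ
  fromℕ n = fromℤ (ℤ.+ n)

  fromℕ-+ : ∀ m n → fromℕ (m ℕ.+ n) ≡ fromℕ m + fromℕ n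
  fromℕ-+ m n = fromℤ-+ (ℤ.+ m) (ℤ.+ n)

  fromℕ-suc : ∀ n → fromℕ (suc n) ≡ 1ℚ + fromℕ n
  fromℕ-suc = fromℕ-+ 1

  fromℕ-* : ∀ m n → fromℕ (m ℕ.* n) ≡ fromℕ m * fromℕ n
  fromℕ-* zero    n = sym (ℚ.*-zeroˡ (fromℕ n))
  fromℕ-* (suc m) n = begin
    fromℕ (n ℕ.+ m ℕ.* n)            ≡⟨ fromℕ-+ n (m ℕ.* n) ⟩
    fromℕ n + fromℕ (m ℕ.* n)        ≡⟨ cong (fromℕ n +_) (fromℕ-* m n) ⟩
    fromℕ n + fromℕ m * fromℕ n      ≡⟨ solve 2 (λ x y → x :+ y :* x := (con 1ℚ :+ y) :* x) refl
                                          (fromℕ n) (fromℕ m) ⟩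
    (1ℚ + fromℕ m) * fromℕ n         ≡⟨ cong (_* fromℕ n) (sym (fromℕ-suc m)) ⟩
    fromℕ (suc m) * fromℕ n          ∎
    where
    open ≡-Reasoning
    open +-*-Solver

  fromℕ-∸ : ∀ {m n} → n ℕ.≤ m → fromℕ (m ℕ.∸ n) ≡ fromℕ m - fromℕ n
  fromℕ-∸ {m} {n} n≤m = begin
    fromℕ (m ℕ.∸ n)                       ≡⟨ solve 2 (λ x y → x := (x :+ y) :- y) refl
                                               (fromℕ (m ℕ.∸ n)) (fromℕ n) ⟩
    (fromℕ (m ℕ.∸ n) + fromℕ n) - fromℕ n ≡⟨ cong (_- fromℕ n) (sym (fromℕ-+ (m ℕ.∸ n) n)) ⟩
    fromℕ (m ℕ.∸ n ℕ.+ n) - fromℕ n       ≡⟨ cong (λ k → fromℕ k - fromℕ n) (ℕ.m∸n+n≡m n≤m) ⟩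
    fromℕ m - fromℕ n                     ∎
    where
    open ≡-Reasoning
    open +-*-Solver

  fromℕ-mono-≤ : ∀ {m n} → m ℕ.≤ n → fromℕ m ≤ fromℕ n
  fromℕ-mono-≤ m≤n = fromℤ-mono-≤ (ℤ.+≤+ m≤n)

  fromℕ-nonNeg : ∀ n → 0ℚ ≤ fromℕ n
  fromℕ-nonNeg n = fromℕ-mono-≤ z≤n

  fromℕ-pos : ∀ {n} → 1 ℕ.≤ n → 0ℚ < fromℕ n
  fromℕ-pos 1≤n = ℚ.<-≤-trans (ℚ.positive⁻¹ 1ℚ) (fromℕ-mono-≤ 1≤n)

  ∣fromℤ∣-mono-≤ : ∀ i {n} → ℤ.∣ i ∣ ℕ.≤ n → ∣ fromℤ i ∣ ≤ fromℕ n
  ∣fromℤ∣-mono-≤ i {n} ∣i∣≤n = subst (_≤ fromℕ n) (sym (∣fromℤ∣ i)) (fromℕ-mono-≤ ∣i∣≤n)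

  ∣fromℤ∣-cancel-≤ : ∀ i {n} → ∣ fromℤ i ∣ ≤ fromℕ n → ℤ.∣ i ∣ ℕ.≤ n
  ∣fromℤ∣-cancel-≤ i {n} ∣i∣≤n =
    ℤ.drop‿+≤+ (fromℤ-cancel-≤ (subst (_≤ fromℕ n) (∣fromℤ∣ i) ∣i∣≤n))

  *-monoʳ-≤-0≤ : ∀ {p q} r → 0ℚ ≤ r → p ≤ q → p * r ≤ q * r
  *-monoʳ-≤-0≤ r 0≤r = ℚ.*-monoʳ-≤-nonNeg r {{nonNegative 0≤r}}

  *-monoˡ-≤-0≤ : ∀ {p q} r → 0ℚ ≤ r → p ≤ q → r * p ≤ r * q
  *-monoˡ-≤-0≤ r 0≤r = ℚ.*-monoˡ-≤-nonNeg r {{nonNegative 0≤r}}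

  *-monoʳ-≤-≤0 : ∀ {p q} r → r ≤ 0ℚ → p ≤ q → q * r ≤ p * r
  *-monoʳ-≤-≤0 r r≤0 = ℚ.*-monoʳ-≤-nonPos r {{nonPositive r≤0}}

  *-nonNeg : ∀ {p q} → 0ℚ ≤ p → 0ℚ ≤ q → 0ℚ ≤ p * q
  *-nonNeg {p} {q} 0≤p 0≤q = subst (_≤ p * q) (ℚ.*-zeroˡ q) (*-monoʳ-≤-0≤ q 0≤q 0≤p)

  ÷-* : ∀ p q .{{_ : NonZero q}} → (p ÷ q) * q ≡ p
  ÷-* p q = trans (ℚ.*-assoc p (1/ q) q) (trans (cong (p *_) (ℚ.*-inverseˡ q)) (ℚ.*-identityʳ p))

  ÷-in-unit : ∀ p q .{{_ : NonZero q}} → 0ℚ < q → 0ℚ ≤ p → p ≤ q → 0ℚ ≤ p ÷ q × p ÷ q ≤ 1ℚ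
  ÷-in-unit p q 0<q 0≤p p≤q =
    ℚ.*-cancelʳ-≤-pos q {{positive 0<q}} (subst₂ _≤_ (sym (ℚ.*-zeroˡ q)) (sym (÷-* p q)) 0≤p) ,
    ℚ.*-cancelʳ-≤-pos q {{positive 0<q}} (subst₂ _≤_ (sym (÷-* p q)) (sym (ℚ.*-identityˡ q)) p≤q)

module LinearDependence {R : Set} where
  open import Data.Rational using (ℚ; 0ℚ; 1ℚ; _+_; _*_; _-_; -_; 1/_; _≟_; ≢-nonZero; NonZero)
  import Data.Rational.Properties as ℚ
  open import Data.Rational.Solver using (module +-*-Solver)
  open +-*-Solver
  open import Data.List using (List; []; _∷_; _++_; length; map; replicate)
  import Data.List.Properties as List
  open import Data.List.Relation.Unary.All as All using (All; []; _∷_)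
  open import Data.List.Relation.Unary.Any using (Any; here; there)
  import Data.List.Relation.Unary.Any.Properties as Any
  open import Data.Nat as ℕ using (ℕ; suc; _<_)
  import Data.Nat.Properties as ℕ
  open import Data.Product using (∃; _×_; _,_)
  open import Data.Sum using (_⊎_; inj₁; inj₂)
  open import Relation.Nullary using (yes; no)
  open import Relation.Binary.PropositionalEquality

  Vector : Set
  Vector = R → ℚ

  combination : List ℚ → List Vector → Vector
  combination (c ∷ cs) (v ∷ vs) r = c * v r + combination cs vs r
  combination _        _        r = 0ℚ

  combination-++ : ∀ c₁ c₂ v₁ v₂ r → length c₁ ≡ length v₁ →
    combination (c₁ ++ c₂) (v₁ ++ v₂) r ≡ combination c₁ v₁ r + combination c₂ v₂ r
  combination-++ []       c₂ []       v₂ r refl = sym (ℚ.+-identityˡ _)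
  combination-++ (c ∷ c₁) c₂ (v ∷ v₁) v₂ r eq =
    trans (cong (c * v r +_) (combination-++ c₁ c₂ v₁ v₂ r (ℕ.suc-injective eq)))
          (sym (ℚ.+-assoc (c * v r) _ _))

  combination-vanishing : ∀ cs vs r → All (λ v → v r ≡ 0ℚ) vs → combination cs vs r ≡ 0ℚ
  combination-vanishing []       _        r _          = refl
  combination-vanishing (c ∷ cs) []       r _          = refl
  combination-vanishing (c ∷ cs) (v ∷ vs) r (vr≡0 ∷ z) = begin
    c * v r + combination cs vs r ≡⟨ cong₂ (λ a b → c * a + b) vr≡0 (combination-vanishing cs vs r z) ⟩
    c * 0ℚ + 0ℚ                   ≡⟨ cong (_+ 0ℚ) (ℚ.*-zeroʳ c) ⟩
    0ℚ                            ∎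
    where open ≡-Reasoning

  -- With q = 1 / p r the result vanishes at coordinate r.
  eliminate : Vector → R → ℚ → Vector → Vector
  eliminate p r q v s = v s - (v r * q) * p s

  combination-eliminate : ∀ p r q cs vs s →
    combination cs (map (eliminate p r q) vs) s ≡ combination cs vs s - (combination cs vs r * q) * p s
  combination-eliminate p r q []       vs       s =
    solve 2 (λ q ps → con 0ℚ := con 0ℚ :- (con 0ℚ :* q) :* ps) refl q (p s)
  combination-eliminate p r q (c ∷ cs) []       s =
    solve 2 (λ q ps → con 0ℚ := con 0ℚ :- (con 0ℚ :* q) :* ps) refl q (p s)
  combination-eliminate p r q (c ∷ cs) (v ∷ vs) s =
    trans (cong (c * eliminate p r q v s +_) (combination-eliminate p r q cs vs s))
      (solve 7 (λ c v vr ps q L Lr → c :* (v :- (vr :* q) :* ps) :+ (L :- (Lr :* q) :* ps)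
                                     := (c :* v :+ L) :- (c :* vr :+ Lr) :* q :* ps)
         refl c (v s) (v r) (p s) q (combination cs vs s) (combination cs vs r))

  Nontrivial : List ℚ → Set
  Nontrivial = Any (λ c → c ≢ 0ℚ)

  record Dependence (rows : List R) (vs : List Vector) : Set where
    field
      coefficients : List ℚ
      length-eq    : length coefficients ≡ length vs
      nontrivial   : Nontrivial coefficients
      vanishes     : All (λ r → combination coefficients vs r ≡ 0ℚ) rows

  pivot? : ∀ r (vs : List Vector) → All (λ v → v r ≡ 0ℚ) vs ⊎
    ∃ λ pre → ∃ λ p → ∃ λ post → vs ≡ pre ++ p ∷ post × p r ≢ 0ℚ
  pivot? r []       = inj₁ []
  pivot? r (v ∷ vs) with v r ≟ 0ℚ | pivot? r vs
  ... | no  vr≢0 | _                              = inj₂ ([] , v , vs , refl , vr≢0)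
  ... | yes vr≡0 | inj₁ z                         = inj₁ (vr≡0 ∷ z)
  ... | yes _    | inj₂ (pre , p , post , eq , n) = inj₂ (v ∷ pre , p , post , cong (v ∷_) eq , n)

  split-at : ∀ {A B : Set} (pre post : List A) (c : List B) → length c ≡ length pre ℕ.+ length post →
    ∃ λ c₁ → ∃ λ c₂ → c ≡ c₁ ++ c₂ × length c₁ ≡ length pre × length c₂ ≡ length post
  split-at []        post c       eq = [] , c , refl , refl , eq
  split-at (_ ∷ pre) post (b ∷ c) eq with split-at pre post c (ℕ.suc-injective eq)
  ... | c₁ , c₂ , refl , l₁ , l₂ = b ∷ c₁ , c₂ , refl , cong suc l₁ , l₂

  module _ (r : R) (pre : List Vector) (p : Vector) (post : List Vector) .{{_ : NonZero (p r)}} where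

    private
      q : ℚ
      q = 1/ p r

    reduce : List Vector
    reduce = map (eliminate p r q) (pre ++ post)

    length-reduce : length reduce ≡ length pre ℕ.+ length post
    length-reduce = trans (List.length-map _ (pre ++ post)) (List.length-++ pre)

    module _ (c₁ c₂ : List ℚ) (l₁ : length c₁ ≡ length pre) where

      private
        L : Vector
        L = combination (c₁ ++ c₂) (pre ++ post)

      -- Each reduced vector is v − (v r / p r) p, so a combination of them is a combination
      -- of the original vectors in which p gets the coefficient α.
      α : ℚ
      α = - (L r * q)

      lifted : ∀ s → combination (c₁ ++ α ∷ c₂) (pre ++ p ∷ post) s ≡ combination (c₁ ++ c₂) reduce s
      lifted s = begin
        combination (c₁ ++ α ∷ c₂) (pre ++ p ∷ post) s
          ≡⟨ combination-++ c₁ (α ∷ c₂) pre (p ∷ post) s l₁ ⟩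
        combination c₁ pre s + (α * p s + combination c₂ post s)
          ≡⟨ solve 4 (λ a b ps x → a :+ (:- x :* ps :+ b) := (a :+ b) :- x :* ps) refl
               (combination c₁ pre s) (combination c₂ post s) (p s) (L r * q) ⟩
        (combination c₁ pre s + combination c₂ post s) - (L r * q) * p s
          ≡⟨ cong (λ z → z - (L r * q) * p s) (sym (combination-++ c₁ c₂ pre post s l₁)) ⟩
        L s - (L r * q) * p s
          ≡⟨ sym (combination-eliminate p r q (c₁ ++ c₂) (pre ++ post) s) ⟩
        combination (c₁ ++ c₂) reduce s ∎
        where open ≡-Reasoning

      reduced-at-r : combination (c₁ ++ c₂) reduce r ≡ 0ℚ
      reduced-at-r = begin
        combination (c₁ ++ c₂) reduce r ≡⟨ combination-eliminate p r q (c₁ ++ c₂) (pre ++ post) r ⟩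
        L r - (L r * q) * p r           ≡⟨ solve 3 (λ x q pr → x :- (x :* q) :* pr := x :- x :* (q :* pr)) refl
                                             (L r) q (p r) ⟩
        L r - L r * (q * p r)           ≡⟨ cong (λ z → L r - L r * z) (ℚ.*-inverseˡ (p r)) ⟩
        L r - L r * 1ℚ                  ≡⟨ solve 1 (λ x → x :- x :* con 1ℚ := con 0ℚ) refl (L r) ⟩
        0ℚ                              ∎
        where open ≡-Reasoning

      insert-nontrivial : Nontrivial (c₁ ++ c₂) → Nontrivial (c₁ ++ α ∷ c₂)
      insert-nontrivial nt with Any.++⁻ c₁ nt
      ... | inj₁ in-c₁ = Any.++⁺ˡ in-c₁
      ... | inj₂ in-c₂ = Any.++⁺ʳ c₁ (there in-c₂)

    lift : ∀ rows → Dependence rows reduce → Dependence (r ∷ rows) (pre ++ p ∷ post)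
    lift rows record { coefficients = c ; length-eq = length-eq ; nontrivial = nt ; vanishes = vanishes }
      with split-at pre post c (trans length-eq length-reduce)
    ... | c₁ , c₂ , refl , l₁ , l₂ = record
      { coefficients = c₁ ++ α c₁ c₂ l₁ ∷ c₂
      ; length-eq    = trans (List.length-++ c₁)
                         (trans (cong₂ (λ a b → a ℕ.+ suc b) l₁ l₂) (sym (List.length-++ pre)))
      ; nontrivial   = insert-nontrivial c₁ c₂ l₁ nt
      ; vanishes     = trans (lifted c₁ c₂ l₁ r) (reduced-at-r c₁ c₂ l₁)
                       ∷ All.map (λ {s} e → trans (lifted c₁ c₂ l₁ s) e) vanishes
      }

  dependence : ∀ rows vs → length rows < length vs → Dependence rows vs
  dependence [] (v ∷ vs) _ = record
    { coefficients = 1ℚ ∷ replicate (length vs) 0ℚ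
    ; length-eq    = cong suc (List.length-replicate (length vs))
    ; nontrivial   = here λ ()
    ; vanishes     = []
    }
  dependence (r ∷ rows) vs long with pivot? r vs
  ... | inj₁ vanish = record
    { coefficients = coefficients
    ; length-eq    = length-eq
    ; nontrivial   = nontrivial
    ; vanishes     = combination-vanishing coefficients vs r vanish ∷ vanishes
    }
    where open Dependence (dependence rows vs (ℕ.<-trans (ℕ.n<1+n _) long))
  ... | inj₂ (pre , p , post , refl , pr≢0) = lift r pre p post rows (dependence rows _ shorter)
    where
    instance
      pr-nonZero : NonZero (p r)
      pr-nonZero = ≢-nonZero pr≢0
    shorter : length rows < length (reduce r pre p post)
    shorter = subst (length rows <_) (sym (length-reduce r pre p post))
                (ℕ.≤-pred (subst (suc (suc (length rows)) ℕ.≤_)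
                   (trans (List.length-++ pre) (ℕ.+-suc (length pre) (length post))) long))

module Steinitz {R : Set} (rows : List R) {A : Set} (vec : A → R → ℚ) where
  open import Data.Rational using (0ℚ; 1ℚ; _+_; _*_; _-_; -_; _≤_; _<_; ∣_∣; _≟_; _<?_; _≤?_)
  open import Data.Rational using (positive; negative; NonZero; ≢-nonZero; _÷_)
  import Data.Rational.Properties as ℚ
  open import Data.Rational.Solver using (module +-*-Solver)
  open +-*-Solver
  open import Data.List using ([]; _∷_; _++_; length; map; take; [_])
  import Data.List.Properties as List
  open import Data.List.Relation.Unary.All as All using (All; []; _∷_)
  import Data.List.Relation.Unary.All.Properties as All
  open import Data.List.Relation.Unary.Any as Any using (Any; here; there)
  open import Data.List.Membership.Propositional using (_∈_; lose; find)
  open import Data.List.Membership.Propositional.Properties using (∈-∃++)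
  open import Data.List.Relation.Binary.Permutation.Propositional
    using (_↭_; refl; prep; swap; trans; ↭-sym)
  import Data.List.Relation.Binary.Permutation.Propositional.Properties as Perm
  open import Data.Nat as ℕ using (ℕ; zero; suc; s≤s; z≤n)
  import Data.Nat.Properties as ℕ
  open import Data.Product using (∃; _×_; _,_; proj₁; proj₂)
  open import Data.Sum as Sum using (_⊎_; inj₁; inj₂; map₂)
  open import Data.Unit using (⊤; tt)
  open import Data.Empty using (⊥-elim)
  open import Function using (_∘_)
  open import Relation.Nullary using (¬_; Dec; yes; no)
  open import Relation.Nullary.Decidable using (_×-dec_)
  open import Relation.Binary using (tri<; tri≈; tri>)
  open import Relation.Binary.PropositionalEquality as ≡ using (_≡_; _≢_; cong; cong₂; subst; subst₂)

  open RationalFacts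
  open LinearDependence {R ⊎ ⊤} using (Dependence; dependence; combination; Nontrivial)

  d : ℕ
  d = length rows

  Bounded : ℚ → (R → ℚ) → Set
  Bounded δ v = All (λ r → ∣ v r ∣ ≤ δ) rows

  sumᵥ : List A → R → ℚ
  sumᵥ []       r = 0ℚ
  sumᵥ (a ∷ as) r = vec a r + sumᵥ as r

  sumᵥ-↭ : ∀ {as bs} → as ↭ bs → ∀ r → sumᵥ as r ≡ sumᵥ bs r
  sumᵥ-↭ refl          r = ≡.refl
  sumᵥ-↭ (prep a p)    r = cong (vec a r +_) (sumᵥ-↭ p r)
  sumᵥ-↭ {_} {b ∷ a ∷ cs} (swap a b p) r =
    ≡.trans (cong (λ z → vec a r + (vec b r + z)) (sumᵥ-↭ p r))
            (solve 3 (λ x y z → x :+ (y :+ z) := y :+ (x :+ z)) ≡.refl (vec a r) (vec b r) (sumᵥ cs r))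
  sumᵥ-↭ (trans p q)   r = ≡.trans (sumᵥ-↭ p r) (sumᵥ-↭ q r)

  Weighted : Set
  Weighted = A × ℚ

  vectors : List Weighted → List A
  vectors = map proj₁

  total-weight : List Weighted → ℚ
  total-weight []            = 0ℚ
  total-weight ((_ , l) ∷ W) = l + total-weight W

  weighted-sum : List Weighted → R → ℚ
  weighted-sum []            r = 0ℚ
  weighted-sum ((a , l) ∷ W) r = l * vec a r + weighted-sum W r

  total-weight-++ : ∀ W W′ → total-weight (W ++ W′) ≡ total-weight W + total-weight W′
  total-weight-++ []            W′ = ≡.sym (ℚ.+-identityˡ _)
  total-weight-++ ((_ , l) ∷ W) W′ =
    ≡.trans (cong (l +_) (total-weight-++ W W′)) (≡.sym (ℚ.+-assoc l _ _))

  weighted-sum-++ : ∀ W W′ r → weighted-sum (W ++ W′) r ≡ weighted-sum W r + weighted-sum W′ r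
  weighted-sum-++ []            W′ r = ≡.sym (ℚ.+-identityˡ _)
  weighted-sum-++ ((a , l) ∷ W) W′ r =
    ≡.trans (cong (l * vec a r +_) (weighted-sum-++ W W′ r)) (≡.sym (ℚ.+-assoc (l * vec a r) _ _))

  record _≈ʷ_ (W W′ : List Weighted) : Set where
    field
      same-vectors : vectors W′ ≡ vectors W
      same-weight  : total-weight W′ ≡ total-weight W
      same-sum     : All (λ r → weighted-sum W′ r ≡ weighted-sum W r) rows

  ≈ʷ-refl : ∀ {W} → W ≈ʷ W
  ≈ʷ-refl = record { same-vectors = ≡.refl ; same-weight = ≡.refl ; same-sum = All.tabulate λ _ → ≡.refl }

  ≈ʷ-trans : ∀ {W W′ W″} → W ≈ʷ W′ → W′ ≈ʷ W″ → W ≈ʷ W″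
  ≈ʷ-trans p q = record
    { same-vectors = ≡.trans (same-vectors q) (same-vectors p)
    ; same-weight  = ≡.trans (same-weight q) (same-weight p)
    ; same-sum     = All.zipWith (λ (e , f) → ≡.trans f e) (same-sum p , same-sum q)
    }
    where open _≈ʷ_

  InUnit : Weighted → Set
  InUnit (_ , l) = 0ℚ ≤ l × l ≤ 1ℚ

  Fractional : ℚ → Set
  Fractional l = 0ℚ < l × l < 1ℚ

  fractional? : ∀ l → Dec (Fractional l)
  fractional? l = (0ℚ <? l) ×-dec (l <? 1ℚ)

  fractionals : List Weighted → List Weighted
  fractionals []      = []
  fractionals (e ∷ W) with fractional? (proj₂ e)
  ... | yes _ = e ∷ fractionals W
  ... | no  _ = fractionals W

  #fractional : List Weighted → ℕ
  #fractional = length ∘ fractionals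

  moment : List (Weighted × ℚ) → (Weighted → ℚ) → ℚ
  moment []            g = 0ℚ
  moment ((e , c) ∷ T) g = c * g e + moment T g

  OnFractional : Weighted × ℚ → Set
  OnFractional ((_ , l) , c) = Fractional l ⊎ c ≡ 0ℚ

  -- T pairs each entry of W with a coefficient c; moving every weight l to l + t c
  -- changes neither the total weight nor the weighted sum.
  record Perturbation (W : List Weighted) (T : List (Weighted × ℚ)) : Set where
    field
      base          : map proj₁ T ≡ W
      on-fractional : All OnFractional T
      weight-free   : moment T (λ _ → 1ℚ) ≡ 0ℚ
      sum-free      : All (λ r → moment T (λ e → vec (proj₁ e) r) ≡ 0ℚ) rows
      nontrivial    : Any (λ x → proj₂ x ≢ 0ℚ) T

  embed : List Weighted → List ℚ → List (Weighted × ℚ)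
  embed []      cs = []
  embed (e ∷ W) cs with fractional? (proj₂ e) | cs
  ... | no  _ | cs′     = (e , 0ℚ) ∷ embed W cs′
  ... | yes _ | []      = (e , 0ℚ) ∷ embed W []
  ... | yes _ | c ∷ cs′ = (e , c) ∷ embed W cs′

  embed-base : ∀ W cs → map proj₁ (embed W cs) ≡ W
  embed-base []      cs = ≡.refl
  embed-base (e ∷ W) cs with fractional? (proj₂ e) | cs
  ... | no  _ | cs′     = cong (e ∷_) (embed-base W cs′)
  ... | yes _ | []      = cong (e ∷_) (embed-base W [])
  ... | yes _ | c ∷ cs′ = cong (e ∷_) (embed-base W cs′)

  embed-on-fractional : ∀ W cs → All OnFractional (embed W cs)
  embed-on-fractional []      cs = []
  embed-on-fractional (e ∷ W) cs with fractional? (proj₂ e) | cs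
  ... | no  _ | cs′     = inj₂ ≡.refl ∷ embed-on-fractional W cs′
  ... | yes _ | []      = inj₂ ≡.refl ∷ embed-on-fractional W []
  ... | yes f | c ∷ cs′ = inj₁ f ∷ embed-on-fractional W cs′

  -- Weights form one extra coordinate, so more than d + 1 fractional entries are dependent.
  extend : Weighted → R ⊎ ⊤ → ℚ
  extend e (inj₁ r) = vec (proj₁ e) r
  extend e (inj₂ _) = 1ℚ

  embed-moment : ∀ W cs x → moment (embed W cs) (λ e → extend e x) ≡ combination cs (map extend (fractionals W)) x
  embed-moment []      []       x = ≡.refl
  embed-moment []      (c ∷ cs) x = ≡.refl
  embed-moment (e ∷ W) cs       x with fractional? (proj₂ e) | cs
  ... | no  _ | cs′     = ≡.trans (cong (0ℚ * extend e x +_) (embed-moment W cs′ x))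
                            (solve 2 (λ u v → con 0ℚ :* u :+ v := v) ≡.refl (extend e x) _)
  ... | yes _ | []      = ≡.trans (cong (0ℚ * extend e x +_) (embed-moment W [] x))
                            (solve 1 (λ u → con 0ℚ :* u :+ con 0ℚ := con 0ℚ) ≡.refl (extend e x))
  ... | yes _ | c ∷ cs′ = cong (c * extend e x +_) (embed-moment W cs′ x)

  embed-nontrivial : ∀ W cs → Nontrivial cs → length cs ≡ #fractional W →
    Any (λ x → proj₂ x ≢ 0ℚ) (embed W cs)
  embed-nontrivial []      []       () _
  embed-nontrivial (e ∷ W) cs nt len with fractional? (proj₂ e) | cs
  ... | no  _ | cs′     = there (embed-nontrivial W cs′ nt len)
  embed-nontrivial (e ∷ W) cs () len | yes _ | []
  ... | yes _ | c ∷ cs′ with nt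
  ...   | here c≢0 = here c≢0
  ...   | there nt′ = there (embed-nontrivial W cs′ nt′ (ℕ.suc-injective len))

  perturbation : ∀ W → suc (suc d) ℕ.≤ #fractional W → ∃ (Perturbation W)
  perturbation W many = embed W c , record
    { base          = embed-base W c
    ; on-fractional = embed-on-fractional W c
    ; weight-free   = ≡.trans (embed-moment W c (inj₂ tt)) (All.head vanishes)
    ; sum-free      = All.map (λ {r} e → ≡.trans (embed-moment W c (inj₁ r)) e)
                        (All.map⁻ (All.tail vanishes))
    ; nontrivial    = embed-nontrivial W c nontrivial (≡.trans length-eq (List.length-map extend (fractionals W)))
    }
    where
    extended-rows : List (R ⊎ ⊤)
    extended-rows = inj₂ tt ∷ map inj₁ rows
    long : length extended-rows ℕ.< length (map extend (fractionals W))
    long = subst₂ (λ m n → suc m ℕ.≤ n) (cong suc (≡.sym (List.length-map inj₁ rows)))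
             (≡.sym (List.length-map extend (fractionals W))) many
    open Dependence (dependence extended-rows (map extend (fractionals W)) long)
    c : List ℚ
    c = coefficients

  HitsBoundary : Weighted × ℚ → ℚ → Set
  HitsBoundary ((_ , l) , c) t = (0ℚ < c × t * c ≡ 1ℚ - l) ⊎ (c < 0ℚ × t * c ≡ - l)

  Admissible : ℚ → Weighted × ℚ → Set
  Admissible t x = proj₂ x ≡ 0ℚ ⊎ ∃ λ h → HitsBoundary x h × t ≤ h

  hit-time : ∀ x → proj₂ x ≢ 0ℚ → ∃ (HitsBoundary x)
  hit-time ((_ , l) , c) c≢0 with ℚ.<-cmp 0ℚ c
  ... | tri< 0<c _ _ = (1ℚ - l) ÷ c , inj₁ (0<c , ÷-* (1ℚ - l) c)
    where instance _ = ≢-nonZero c≢0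
  ... | tri≈ _ 0≡c _ = ⊥-elim (c≢0 (≡.sym 0≡c))
  ... | tri> _ _ c<0 = (- l) ÷ c , inj₂ (c<0 , ÷-* (- l) c)
    where instance _ = ≢-nonZero c≢0

  hit-time-nonNeg : ∀ x {h} → Fractional (proj₂ (proj₁ x)) → HitsBoundary x h → 0ℚ ≤ h
  hit-time-nonNeg ((_ , l) , c) {h} (0<l , l<1) H with ℚ.<-cmp h 0ℚ | H
  ... | tri≈ _ h≡0 _ | _ = ℚ.≤-reflexive (≡.sym h≡0)
  ... | tri> _ _ 0<h | _ = ℚ.<⇒≤ 0<h
  ... | tri< h<0 _ _ | inj₁ (0<c , hc≡1-l) = ⊥-elim (ℚ.<-asym 0<1-l (subst (_< 0ℚ) hc≡1-l hc<0))
    where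
    0<1-l : 0ℚ < 1ℚ - l
    0<1-l = subst (_< 1ℚ - l) (ℚ.+-inverseʳ l) (ℚ.+-monoˡ-< (- l) l<1)
    hc<0 : h * c < 0ℚ
    hc<0 = subst (h * c <_) (ℚ.*-zeroˡ c) (ℚ.*-monoˡ-<-pos c {{positive 0<c}} h<0)
  ... | tri< h<0 _ _ | inj₂ (c<0 , hc≡-l) = ⊥-elim (ℚ.<-asym (ℚ.neg-antimono-< 0<l) (subst (0ℚ <_) hc≡-l 0<hc))
    where
    0<hc : 0ℚ < h * c
    0<hc = subst (_< h * c) (ℚ.*-zeroˡ c) (ℚ.*-monoˡ-<-neg c {{negative c<0}} h<0)

  clamp : ∀ T b → ∃ λ t → t ≤ b × All (Admissible t) T × (t ≡ b ⊎ Any (λ x → HitsBoundary x t) T)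
  clamp []      b = b , ℚ.≤-refl , [] , inj₁ ≡.refl
  clamp (x ∷ T) b with proj₂ x ≟ 0ℚ
  ... | yes c≡0 with clamp T b
  ...   | t , t≤b , adm , src = t , t≤b , inj₁ c≡0 ∷ adm , map₂ there src
  clamp (x ∷ T) b | no c≢0 with hit-time x c≢0
  ... | h , H with h ≤? b
  ...   | yes h≤b with clamp T h
  ...     | t , t≤h , adm , inj₁ ≡.refl = t , h≤b , inj₂ (t , H , ℚ.≤-refl) ∷ adm , inj₂ (here H)
  ...     | t , t≤h , adm , inj₂ hits   =
    t , ℚ.≤-trans t≤h h≤b , inj₂ (h , H , t≤h) ∷ adm , inj₂ (there hits)
  clamp (x ∷ T) b | no c≢0 | h , H | no h≰b with clamp T b
  ...     | t , t≤b , adm , src =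
    t , t≤b , inj₂ (h , H , ℚ.≤-trans t≤b (ℚ.<⇒≤ (ℚ.≰⇒> h≰b))) ∷ adm , map₂ there src

  first-hit : ∀ T → Any (λ x → proj₂ x ≢ 0ℚ) T →
    ∃ λ t → All (Admissible t) T × Any (λ x → HitsBoundary x t) T
  first-hit T nz with find nz
  ... | x , x∈T , c≢0 with hit-time x c≢0
  ...   | h , H with clamp T h
  ...     | t , _ , adm , inj₁ ≡.refl = t , adm , lose x∈T H
  ...     | t , _ , adm , inj₂ hits   = t , adm , hits

  move : ℚ → Weighted × ℚ → Weighted
  move t ((a , l) , c) = a , l + t * c

  +-*-zeroʳ : ∀ p t → p + t * 0ℚ ≡ p
  +-*-zeroʳ p t = ≡.trans (cong (p +_) (ℚ.*-zeroʳ t)) (ℚ.+-identityʳ p)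

  vectors-move : ∀ t T → vectors (map (move t) T) ≡ vectors (map proj₁ T)
  vectors-move t []                  = ≡.refl
  vectors-move t (((a , _) , _) ∷ T) = cong (a ∷_) (vectors-move t T)

  total-weight-move : ∀ t T →
    total-weight (map (move t) T) ≡ total-weight (map proj₁ T) + t * moment T (λ _ → 1ℚ)
  total-weight-move t []                  = solve 1 (λ t → con 0ℚ := con 0ℚ :+ t :* con 0ℚ) ≡.refl t
  total-weight-move t (((a , l) , c) ∷ T) =
    ≡.trans (cong (l + t * c +_) (total-weight-move t T))
      (solve 5 (λ l t c L S → l :+ t :* c :+ (L :+ t :* S) := l :+ L :+ t :* (c :* con 1ℚ :+ S)) ≡.refl
         l t c (total-weight (map proj₁ T)) (moment T (λ _ → 1ℚ)))

  weighted-sum-move : ∀ t T r →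
    weighted-sum (map (move t) T) r ≡ weighted-sum (map proj₁ T) r + t * moment T (λ e → vec (proj₁ e) r)
  weighted-sum-move t []                  r = solve 1 (λ t → con 0ℚ := con 0ℚ :+ t :* con 0ℚ) ≡.refl t
  weighted-sum-move t (((a , l) , c) ∷ T) r =
    ≡.trans (cong ((l + t * c) * vec a r +_) (weighted-sum-move t T r))
      (solve 6 (λ l t c v L S → (l :+ t :* c) :* v :+ (L :+ t :* S) := l :* v :+ L :+ t :* (c :* v :+ S)) ≡.refl
         l t c (vec a r) (weighted-sum (map proj₁ T) r) (moment T (λ e → vec (proj₁ e) r)))

  move-≈ʷ : ∀ {W T} t → Perturbation W T → W ≈ʷ map (move t) T
  move-≈ʷ {W} {T} t P = record
    { same-vectors = ≡.trans (vectors-move t T) (cong vectors base)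
    ; same-weight  = ≡.trans (total-weight-move t T)
                       (≡.trans (cong₂ (λ V m → total-weight V + t * m) base weight-free) (+-*-zeroʳ _ t))
    ; same-sum     = All.map (λ {r} m≡0 → ≡.trans (weighted-sum-move t T r)
                       (≡.trans (cong₂ (λ V m → weighted-sum V r + t * m) base m≡0) (+-*-zeroʳ _ t))) sum-free
    }
    where open Perturbation P

  move-in-unit : ∀ {t} x → 0ℚ ≤ t → InUnit (proj₁ x) → Admissible t x → InUnit (move t x)
  move-in-unit {t} ((a , l) , c) _ (0≤l , l≤1) (inj₁ c≡0) =
    subst (λ z → 0ℚ ≤ z × z ≤ 1ℚ) (≡.sym (≡.trans (cong (λ z → l + t * z) c≡0) (+-*-zeroʳ l t))) (0≤l , l≤1)
  move-in-unit {t} ((a , l) , c) 0≤t (0≤l , l≤1) (inj₂ (h , inj₁ (0<c , hc≡1-l) , t≤h)) =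
    ℚ.≤-trans 0≤l
      (subst (_≤ l + t * c) (ℚ.+-identityʳ l) (ℚ.+-monoʳ-≤ l (*-nonNeg 0≤t (ℚ.<⇒≤ 0<c)))) ,
    subst (l + t * c ≤_) (solve 1 (λ l → l :+ (con 1ℚ :- l) := con 1ℚ) ≡.refl l)
      (ℚ.+-monoʳ-≤ l (subst (t * c ≤_) hc≡1-l (*-monoʳ-≤-0≤ c (ℚ.<⇒≤ 0<c) t≤h)))
  move-in-unit {t} ((a , l) , c) 0≤t (0≤l , l≤1) (inj₂ (h , inj₂ (c<0 , hc≡-l) , t≤h)) =
    subst (_≤ l + t * c) (solve 1 (λ l → l :+ (:- l) := con 0ℚ) ≡.refl l)
      (ℚ.+-monoʳ-≤ l (subst (_≤ t * c) hc≡-l (*-monoʳ-≤-≤0 c (ℚ.<⇒≤ c<0) t≤h))) ,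
    ℚ.≤-trans (subst (l + t * c ≤_) (ℚ.+-identityʳ l) (ℚ.+-monoʳ-≤ l
      (subst (t * c ≤_) (ℚ.*-zeroˡ c) (*-monoʳ-≤-≤0 c (ℚ.<⇒≤ c<0) 0≤t)))) l≤1

  fractional-move : ∀ t x → OnFractional x → Fractional (proj₂ (move t x)) → Fractional (proj₂ (proj₁ x))
  fractional-move t ((a , l) , c) (inj₁ f)   _ = f
  fractional-move t ((a , l) , c) (inj₂ c≡0) f =
    subst Fractional (≡.trans (cong (λ z → l + t * z) c≡0) (+-*-zeroʳ l t)) f

  move-hit : ∀ t x → HitsBoundary x t → ¬ Fractional (proj₂ (move t x))
  move-hit t ((a , l) , c) (inj₁ (_ , tc≡1-l)) (_ , l+tc<1) =
    ℚ.<-irrefl (≡.trans (cong (l +_) tc≡1-l) (solve 1 (λ l → l :+ (con 1ℚ :- l) := con 1ℚ) ≡.refl l)) l+tc<1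
  move-hit t ((a , l) , c) (inj₂ (_ , tc≡-l)) (0<l+tc , _) =
    ℚ.<-irrefl (≡.sym (≡.trans (cong (l +_) tc≡-l) (solve 1 (λ l → l :+ (:- l) := con 0ℚ) ≡.refl l))) 0<l+tc

  module _ {X : Set} (f g : X → Weighted) where

    FractionalOnlyIf : X → Set
    FractionalOnlyIf x = Fractional (proj₂ (f x)) → Fractional (proj₂ (g x))

    #fractional-map-≤ : ∀ xs → All FractionalOnlyIf xs → #fractional (map f xs) ℕ.≤ #fractional (map g xs)
    #fractional-map-≤ []       _ = z≤n
    #fractional-map-≤ (x ∷ xs) (i ∷ is) with fractional? (proj₂ (f x)) | fractional? (proj₂ (g x))
    ... | yes _  | yes _  = s≤s (#fractional-map-≤ xs is)
    ... | yes fx | no ¬gx = ⊥-elim (¬gx (i fx))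
    ... | no  _  | yes _  = ℕ.m≤n⇒m≤1+n (#fractional-map-≤ xs is)
    ... | no  _  | no  _  = #fractional-map-≤ xs is

    #fractional-map-< : ∀ xs → All FractionalOnlyIf xs →
      Any (λ x → ¬ Fractional (proj₂ (f x)) × Fractional (proj₂ (g x))) xs →
      #fractional (map f xs) ℕ.< #fractional (map g xs)
    #fractional-map-< (x ∷ xs) (i ∷ is) strict with fractional? (proj₂ (f x)) | fractional? (proj₂ (g x)) | strict
    ... | yes fx | no ¬gx | _                = ⊥-elim (¬gx (i fx))
    ... | yes fx | yes _  | here (¬fx , _)  = ⊥-elim (¬fx fx)
    ... | yes _  | yes _  | there strict′   = s≤s (#fractional-map-< xs is strict′)
    ... | no  _  | yes _  | _               = s≤s (#fractional-map-≤ xs is)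
    ... | no  _  | no ¬gx | here (_ , gx)   = ⊥-elim (¬gx gx)
    ... | no  _  | no  _  | there strict′   = #fractional-map-< xs is strict′

  #fractional≤length : ∀ W → #fractional W ℕ.≤ length W
  #fractional≤length []      = z≤n
  #fractional≤length (e ∷ W) with fractional? (proj₂ e)
  ... | yes _ = s≤s (#fractional≤length W)
  ... | no  _ = ℕ.m≤n⇒m≤1+n (#fractional≤length W)

  hit-fractional : ∀ x {h} → OnFractional x → HitsBoundary x h → Fractional (proj₂ (proj₁ x))
  hit-fractional x (inj₁ f) _ = f
  hit-fractional x (inj₂ ≡.refl) (inj₁ (0<0 , _)) = ⊥-elim (ℚ.<-irrefl ≡.refl 0<0)
  hit-fractional x (inj₂ ≡.refl) (inj₂ (0<0 , _)) = ⊥-elim (ℚ.<-irrefl ≡.refl 0<0)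

  -- Carathéodory-type reduction: move the weights along a perturbation until the
  -- first fractional weight reaches 0 or 1.
  reduce-step : ∀ W → All InUnit W → suc (suc d) ℕ.≤ #fractional W →
    ∃ λ W′ → W ≈ʷ W′ × All InUnit W′ × #fractional W′ ℕ.< #fractional W
  reduce-step W in-unit many = map (move t) T , move-≈ʷ t P , in-unit′ , fewer
    where
    T : List (Weighted × ℚ)
    T = proj₁ (perturbation W many)
    P : Perturbation W T
    P = proj₂ (perturbation W many)
    open Perturbation P
    t : ℚ
    t = proj₁ (first-hit T nontrivial)
    admissible : All (Admissible t) T
    admissible = proj₁ (proj₂ (first-hit T nontrivial))
    x : Weighted × ℚ
    x = proj₁ (find (proj₂ (proj₂ (first-hit T nontrivial))))
    x∈T : x ∈ T
    x∈T = proj₁ (proj₂ (find (proj₂ (proj₂ (first-hit T nontrivial)))))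
    x-hits : HitsBoundary x t
    x-hits = proj₂ (proj₂ (find (proj₂ (proj₂ (first-hit T nontrivial)))))
    x-fractional : Fractional (proj₂ (proj₁ x))
    x-fractional = hit-fractional x {t} (All.lookup on-fractional x∈T) x-hits
    0≤t : 0ℚ ≤ t
    0≤t = hit-time-nonNeg x x-fractional x-hits
    in-unit′ : All InUnit (map (move t) T)
    in-unit′ = All.map⁺ (All.zipWith (λ {x} (i , a) → move-in-unit x 0≤t i a)
                 (All.map⁻ (subst (All InUnit) (≡.sym base) in-unit) , admissible))
    fewer : #fractional (map (move t) T) ℕ.< #fractional W
    fewer = subst (λ V → #fractional (map (move t) T) ℕ.< #fractional V) base
              (#fractional-map-< (move t) proj₁ T (All.map (λ {x} → fractional-move t x) on-fractional)
                (lose x∈T (move-hit t x x-hits , x-fractional)))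

  reduce-fractional : ∀ n W → #fractional W ℕ.≤ n → All InUnit W →
    ∃ λ W′ → W ≈ʷ W′ × All InUnit W′ × #fractional W′ ℕ.≤ suc d
  reduce-fractional n W bound in-unit with #fractional W ℕ.≤? suc d
  ... | yes few = W , ≈ʷ-refl , in-unit , few
  reduce-fractional zero    W bound in-unit | no many = ⊥-elim (many (ℕ.≤-trans bound z≤n))
  reduce-fractional (suc n) W bound in-unit | no many =
    let W₁ , W≈W₁ , in-unit₁ , fewer = reduce-step W in-unit (ℕ.≰⇒> many)
        W′ , W₁≈W′ , in-unit′ , few = reduce-fractional n W₁ (ℕ.≤-pred (ℕ.≤-trans fewer bound)) in-unit₁
    in W′ , ≈ʷ-trans W≈W₁ W₁≈W′ , in-unit′ , few

  slack : List Weighted → ℚ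
  slack []            = 0ℚ
  slack ((_ , l) ∷ W) = (1ℚ - l) + slack W

  slack≡ : ∀ W → slack W ≡ fromℕ (length W) - total-weight W
  slack≡ []            = ≡.refl
  slack≡ ((_ , l) ∷ W) = begin
    (1ℚ - l) + slack W                   ≡⟨ cong ((1ℚ - l) +_) (slack≡ W) ⟩
    (1ℚ - l) + (fromℕ n - total-weight W) ≡⟨ solve 3 (λ l n L → (con 1ℚ :- l) :+ (n :- L) := (con 1ℚ :+ n) :- (l :+ L))
                                              ≡.refl l (fromℕ n) (total-weight W) ⟩
    (1ℚ + fromℕ n) - (l + total-weight W) ≡⟨ cong (_- (l + total-weight W)) (≡.sym (fromℕ-suc n)) ⟩
    fromℕ (suc n) - (l + total-weight W)  ∎
    where
    open ≡.≡-Reasoning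
    n = length W

  slack-of : ∀ {m k} W → length W ≡ m → total-weight W ≡ fromℕ k → k ℕ.≤ m →
    slack W ≡ fromℕ (m ℕ.∸ k)
  slack-of {m} {k} W length-eq weight k≤m = begin
    slack W                           ≡⟨ slack≡ W ⟩
    fromℕ (length W) - total-weight W ≡⟨ cong₂ (λ m w → fromℕ m - w) length-eq weight ⟩
    fromℕ m - fromℕ k                 ≡⟨ ≡.sym (fromℕ-∸ k≤m) ⟩
    fromℕ (m ℕ.∸ k)                   ∎
    where open ≡.≡-Reasoning

  1-l<1 : ∀ {l} → 0ℚ < l → 1ℚ - l < 1ℚ
  1-l<1 {l} 0<l = subst (1ℚ - l <_) (ℚ.+-identityʳ 1ℚ) (ℚ.+-monoʳ-< 1ℚ (ℚ.neg-antimono-< 0<l))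

  non-fractional-weight : ∀ {l} → 0ℚ ≤ l → l ≤ 1ℚ → l ≢ 0ℚ → ¬ Fractional l → l ≡ 1ℚ
  non-fractional-weight {l} 0≤l l≤1 l≢0 ¬f with ℚ.<-cmp 0ℚ l
  ... | tri< 0<l _ _ = ℚ.≤-antisym l≤1 (ℚ.≮⇒≥ λ l<1 → ¬f (0<l , l<1))
  ... | tri≈ _ 0≡l _ = ⊥-elim (l≢0 (≡.sym 0≡l))
  ... | tri> _ _ l<0 = ⊥-elim (ℚ.<-irrefl ≡.refl (ℚ.<-≤-trans l<0 0≤l))

  -- Each fractional weight contributes less than 1 to the slack, each weight 1 nothing.
  slack-small : ∀ W → All (λ e → InUnit e × proj₂ e ≢ 0ℚ) W →
    slack W < fromℕ (#fractional W) ⊎ slack W ≡ 0ℚ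
  slack-small []            [] = inj₂ ≡.refl
  slack-small ((a , l) ∷ W) (((0≤l , l≤1) , l≢0) ∷ rest) with fractional? l | slack-small W rest
  ... | yes (0<l , _) | inj₁ small =
    inj₁ (subst (1ℚ - l + slack W <_) (≡.sym (fromℕ-suc (#fractional W))) (ℚ.+-mono-< (1-l<1 0<l) small))
  ... | yes (0<l , _) | inj₂ slack≡0 =
    inj₁ (subst (_< fromℕ (suc (#fractional W)))
            (≡.trans (≡.sym (ℚ.+-identityʳ (1ℚ - l))) (cong ((1ℚ - l) +_) (≡.sym slack≡0)))
            (ℚ.<-≤-trans (1-l<1 0<l) (fromℕ-mono-≤ (s≤s z≤n))))
  ... | no ¬f | ih with non-fractional-weight 0≤l l≤1 l≢0 ¬f
  ...   | ≡.refl = Sum.map (subst (_< fromℕ (#fractional W)) (≡.sym (ℚ.+-identityˡ (slack W))))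
                           (≡.trans (ℚ.+-identityˡ (slack W))) ih

  zero-weight : ∀ W → All InUnit W → slack W ≡ fromℕ (suc d) → #fractional W ℕ.≤ suc d →
    Any (λ e → proj₂ e ≡ 0ℚ) W
  zero-weight W in-unit slack≡ few with Any.any? (λ e → proj₂ e ≟ 0ℚ) W
  ... | yes z  = z
  ... | no  ¬z with slack-small W (All.zip (in-unit , All.¬Any⇒All¬ W ¬z))
  ...   | inj₁ small   =
    ⊥-elim (ℚ.<-irrefl ≡.refl
      (ℚ.<-≤-trans (subst (_< fromℕ (#fractional W)) slack≡ small) (fromℕ-mono-≤ few)))
  ...   | inj₂ slack≡0 = ⊥-elim (ℚ.<-irrefl (≡.trans (≡.sym slack≡0) slack≡) (fromℕ-pos (s≤s z≤n)))

  scale : ℚ → List Weighted → List Weighted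
  scale s = map λ (a , l) → a , s * l

  vectors-scale : ∀ s W → vectors (scale s W) ≡ vectors W
  vectors-scale s []      = ≡.refl
  vectors-scale s (e ∷ W) = cong (proj₁ e ∷_) (vectors-scale s W)

  total-weight-scale : ∀ s W → total-weight (scale s W) ≡ s * total-weight W
  total-weight-scale s []            = ≡.sym (ℚ.*-zeroʳ s)
  total-weight-scale s ((_ , l) ∷ W) =
    ≡.trans (cong (s * l +_) (total-weight-scale s W)) (≡.sym (ℚ.*-distribˡ-+ s l _))

  weighted-sum-scale : ∀ s W r → weighted-sum (scale s W) r ≡ s * weighted-sum W r
  weighted-sum-scale s []            r = ≡.sym (ℚ.*-zeroʳ s)
  weighted-sum-scale s ((a , l) ∷ W) r =
    ≡.trans (cong (s * l * vec a r +_) (weighted-sum-scale s W r))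
      (solve 4 (λ s l v w → s :* l :* v :+ s :* w := s :* (l :* v :+ w)) ≡.refl s l (vec a r) (weighted-sum W r))

  scale-in-unit : ∀ {s} W → 0ℚ ≤ s → s ≤ 1ℚ → All InUnit W → All InUnit (scale s W)
  scale-in-unit     []            _   _   []                   = []
  scale-in-unit {s} ((a , l) ∷ W) 0≤s s≤1 ((0≤l , l≤1) ∷ rest) =
    (*-nonNeg 0≤s 0≤l , ℚ.≤-trans (subst (s * l ≤_) (ℚ.*-identityʳ s) (*-monoˡ-≤-0≤ s 0≤s l≤1)) s≤1)
    ∷ scale-in-unit W 0≤s s≤1 rest

  remove-zero-weight : ∀ pre x post → proj₂ x ≡ 0ℚ →
    vectors (pre ++ x ∷ post) ↭ vectors (pre ++ post) ++ [ proj₁ x ] ×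
    total-weight (pre ++ x ∷ post) ≡ total-weight (pre ++ post) ×
    (∀ r → weighted-sum (pre ++ x ∷ post) r ≡ weighted-sum (pre ++ post) r)
  remove-zero-weight pre (a , l) post ≡.refl = permutation , weight , sum
    where
    permutation : vectors (pre ++ (a , 0ℚ) ∷ post) ↭ vectors (pre ++ post) ++ [ a ]
    permutation = subst₂ (λ u v → u ↭ v ++ [ a ])
      (≡.sym (List.map-++ proj₁ pre ((a , 0ℚ) ∷ post))) (≡.sym (List.map-++ proj₁ pre post)) (trans (Perm.shift a (vectors pre) (vectors post)) (Perm.∷↭∷ʳ a (vectors pre ++ vectors post)))
    weight : total-weight (pre ++ (a , 0ℚ) ∷ post) ≡ total-weight (pre ++ post)
    weight = ≡.trans (total-weight-++ pre _)
      (≡.trans (cong (total-weight pre +_) (ℚ.+-identityˡ _)) (≡.sym (total-weight-++ pre post)))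
    sum : ∀ r → weighted-sum (pre ++ (a , 0ℚ) ∷ post) r ≡ weighted-sum (pre ++ post) r
    sum r = ≡.trans (weighted-sum-++ pre _ r)
      (≡.trans (cong (λ z → weighted-sum pre r + (z + weighted-sum post r)) (ℚ.*-zeroˡ (vec a r)))
        (≡.trans (cong (weighted-sum pre r +_) (ℚ.+-identityˡ _)) (≡.sym (weighted-sum-++ pre post r))))

  record Balanced (n : ℕ) (w : ℚ) (W : List Weighted) : Set where
    field
      length-eq : length W ≡ n
      in-unit   : All InUnit W
      weight    : total-weight W ≡ w
      balanced  : All (λ r → weighted-sum W r ≡ 0ℚ) rows

  reduce-balanced : ∀ {n w} W → Balanced n w W →
    ∃ λ W′ → vectors W′ ≡ vectors W × Balanced n w W′ × #fractional W′ ℕ.≤ suc d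
  reduce-balanced W B with reduce-fractional (length W) W (#fractional≤length W) (Balanced.in-unit B)
  ... | W′ , W≈W′ , in-unit′ , few = W′ , same-vectors , record
    { length-eq = ≡.trans (≡.sym (List.length-map proj₁ W′))
                    (≡.trans (cong length same-vectors) (≡.trans (List.length-map proj₁ W) length-eq))
    ; in-unit   = in-unit′
    ; weight    = ≡.trans same-weight weight
    ; balanced  = All.zipWith (λ (e , z) → ≡.trans e z) (same-sum , balanced)
    } , few
    where
    open _≈ʷ_ W≈W′
    open Balanced B

  remove-zero-entry : ∀ {n w} W → Balanced (suc n) w W → Any (λ e → proj₂ e ≡ 0ℚ) W →
    ∃ λ W′ → ∃ λ a → vectors W ↭ vectors W′ ++ [ a ] × Balanced n w W′
  remove-zero-entry W B has-zero with find has-zero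
  ... | x , x∈W , x≡0 with ∈-∃++ x∈W
  ...   | pre , post , ≡.refl with remove-zero-weight pre x post x≡0
  ...     | permutation , same-weight , same-sum = pre ++ post , proj₁ x , permutation , record
    { length-eq = ℕ.suc-injective (begin
        suc (length (pre ++ post))          ≡⟨ cong suc (List.length-++ pre) ⟩
        suc (length pre ℕ.+ length post)    ≡⟨ ≡.sym (ℕ.+-suc (length pre) (length post)) ⟩
        length pre ℕ.+ length (x ∷ post)    ≡⟨ ≡.sym (List.length-++ pre) ⟩
        length (pre ++ x ∷ post)            ≡⟨ length-eq ⟩
        suc _                               ∎)
    ; in-unit   = All.++⁺ (proj₁ split) (All.tail (proj₂ split))
    ; weight    = ≡.trans (≡.sym same-weight) weight
    ; balanced  = All.map (λ {r} z → ≡.trans (≡.sym (same-sum r)) z) balanced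
    }
    where
    open Balanced B
    open ≡.≡-Reasoning
    split : All InUnit pre × All InUnit (x ∷ post)
    split = All.++⁻ pre in-unit

  -- Scale the weights to total n − d and make at most d + 1 of them fractional:
  -- the slack is then d + 1, which forces a zero weight.
  remove-one : ∀ n W → d ℕ.≤ n → Balanced (suc n) (fromℕ (suc n ℕ.∸ d)) W →
    ∃ λ W′ → ∃ λ a → vectors W ↭ vectors W′ ++ [ a ] × Balanced n (fromℕ (n ℕ.∸ d)) W′
  remove-one n W d≤n B =
    let W₂ , same-vectors , B₂ , few = reduce-balanced (scale s W) scaled
        W′ , a , split , B′ = remove-zero-entry W₂ B₂
          (zero-weight W₂ (Balanced.in-unit B₂) (slack₂ B₂) few)
    in W′ , a , subst (_↭ vectors W′ ++ [ a ]) (≡.trans same-vectors (vectors-scale s W)) split , B′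
    where
    open Balanced B
    k : ℕ
    k = n ℕ.∸ d
    suc-k : suc n ℕ.∸ d ≡ suc k
    suc-k = ℕ.+-∸-assoc 1 d≤n
    slack₂ : ∀ {W₂} → Balanced (suc n) (fromℕ k) W₂ → slack W₂ ≡ fromℕ (suc d)
    slack₂ {W₂} B₂ = ≡.trans
      (slack-of W₂ (Balanced.length-eq B₂) (Balanced.weight B₂) (ℕ.m≤n⇒m≤1+n (ℕ.m∸n≤m n d)))
      (cong fromℕ (≡.trans (ℕ.+-∸-assoc 1 (ℕ.m∸n≤m n d)) (cong suc (ℕ.m∸[m∸n]≡n d≤n))))
    instance
      suc-k-nonZero : NonZero (fromℕ (suc k))
      suc-k-nonZero = _
    s : ℚ
    s = fromℕ k ÷ fromℕ (suc k)
    s-in-unit : 0ℚ ≤ s × s ≤ 1ℚ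
    s-in-unit = ÷-in-unit (fromℕ k) (fromℕ (suc k)) (fromℕ-pos (s≤s z≤n)) (fromℕ-nonNeg k)
                  (fromℕ-mono-≤ (ℕ.n≤1+n k))
    scaled : Balanced (suc n) (fromℕ k) (scale s W)
    scaled = record
      { length-eq = ≡.trans (List.length-map _ W) length-eq
      ; in-unit   = scale-in-unit W (proj₁ s-in-unit) (proj₂ s-in-unit) in-unit
      ; weight    = ≡.trans (total-weight-scale s W)
                      (≡.trans (cong (s *_) (≡.trans weight (cong fromℕ suc-k))) (÷-* (fromℕ k) (fromℕ (suc k))))
      ; balanced  = All.map (λ {r} z → ≡.trans (weighted-sum-scale s W r)
                                         (≡.trans (cong (s *_) z) (ℚ.*-zeroʳ s))) balanced
      }

  PrefixBounded : ℚ → List A → Set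
  PrefixBounded δ P = ∀ k → Bounded δ (sumᵥ (take k P))

  VectorsBounded : ℚ → List A → Set
  VectorsBounded δ = All (Bounded δ ∘ vec)

  sumᵥ-bound : ∀ δ as → VectorsBounded δ as → Bounded (fromℕ (length as) * δ) (sumᵥ as)
  sumᵥ-bound δ []       _         = All.tabulate λ _ → ℚ.≤-reflexive (≡.sym (ℚ.*-zeroˡ δ))
  sumᵥ-bound δ (a ∷ as) (va ∷ vs) = All.zipWith step (va , sumᵥ-bound δ as vs)
    where
    step : ∀ {r} → (∣ vec a r ∣ ≤ δ) × (∣ sumᵥ as r ∣ ≤ fromℕ (length as) * δ) →
           ∣ vec a r + sumᵥ as r ∣ ≤ fromℕ (suc (length as)) * δ
    step {r} (p , q) = ℚ.≤-trans (ℚ.∣p+q∣≤∣p∣+∣q∣ (vec a r) (sumᵥ as r))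
      (subst (∣ vec a r ∣ + ∣ sumᵥ as r ∣ ≤_)
        (≡.trans (solve 2 (λ δ n → δ :+ n :* δ := (con 1ℚ :+ n) :* δ) ≡.refl δ (fromℕ (length as)))
                 (cong (_* δ) (≡.sym (fromℕ-suc (length as)))))
        (ℚ.+-mono-≤ p q))

  short-prefixes : ∀ δ as → 0ℚ ≤ δ → length as ℕ.≤ d → VectorsBounded δ as →
    PrefixBounded (fromℕ d * δ) as
  short-prefixes δ as 0≤δ short bounded k =
    All.map (λ p → ℚ.≤-trans p (*-monoʳ-≤-0≤ δ 0≤δ (fromℕ-mono-≤ (ℕ.≤-trans length-take≤ short))))
      (sumᵥ-bound δ (take k as) (All.take⁺ k bounded))
    where
    length-take≤ : length (take k as) ℕ.≤ length as
    length-take≤ = subst (ℕ._≤ length as) (≡.sym (List.length-take k as)) (ℕ.m⊓n≤n k (length as))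

  slack-sum : List Weighted → R → ℚ
  slack-sum []            r = 0ℚ
  slack-sum ((a , l) ∷ W) r = (1ℚ - l) * vec a r + slack-sum W r

  sumᵥ-vectors : ∀ W r → sumᵥ (vectors W) r ≡ slack-sum W r + weighted-sum W r
  sumᵥ-vectors []            r = ≡.refl
  sumᵥ-vectors ((a , l) ∷ W) r = ≡.trans (cong (vec a r +_) (sumᵥ-vectors W r))
    (solve 4 (λ v l o w → v :+ (o :+ w) := ((con 1ℚ :- l) :* v :+ o) :+ (l :* v :+ w)) ≡.refl
       (vec a r) l (slack-sum W r) (weighted-sum W r))

  slack-sum-bound : ∀ δ W → All InUnit W → VectorsBounded δ (vectors W) → Bounded (slack W * δ) (slack-sum W)
  slack-sum-bound δ []            _                     _         =
    All.tabulate λ _ → ℚ.≤-reflexive (≡.sym (ℚ.*-zeroˡ δ))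
  slack-sum-bound δ ((a , l) ∷ W) ((_ , l≤1) ∷ in-unit) (va ∷ vs) =
    All.zipWith step (va , slack-sum-bound δ W in-unit vs)
    where
    0≤1-l : 0ℚ ≤ 1ℚ - l
    0≤1-l = subst (_≤ 1ℚ - l) (ℚ.+-inverseʳ l) (ℚ.+-monoˡ-≤ (- l) l≤1)
    step : ∀ {r} → (∣ vec a r ∣ ≤ δ) × (∣ slack-sum W r ∣ ≤ slack W * δ) →
           ∣ (1ℚ - l) * vec a r + slack-sum W r ∣ ≤ ((1ℚ - l) + slack W) * δ
    step {r} (p , q) = ℚ.≤-trans (ℚ.∣p+q∣≤∣p∣+∣q∣ ((1ℚ - l) * vec a r) (slack-sum W r))
      (subst (∣ (1ℚ - l) * vec a r ∣ + ∣ slack-sum W r ∣ ≤_) (≡.sym (ℚ.*-distribʳ-+ δ (1ℚ - l) (slack W)))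
        (ℚ.+-mono-≤ (subst (_≤ (1ℚ - l) * δ) (≡.sym ∣[1-l]v∣) (*-monoˡ-≤-0≤ (1ℚ - l) 0≤1-l p)) q))
      where
      ∣[1-l]v∣ : ∣ (1ℚ - l) * vec a r ∣ ≡ (1ℚ - l) * ∣ vec a r ∣
      ∣[1-l]v∣ = ≡.trans (ℚ.∣p*q∣≡∣p∣*∣q∣ (1ℚ - l) (vec a r)) (cong (_* ∣ vec a r ∣) (ℚ.0≤p⇒∣p∣≡p 0≤1-l))

  take-∷ʳ : ∀ {X : Set} k (xs : List X) x → take k (xs ++ [ x ]) ≡ take k xs ⊎ take k (xs ++ [ x ]) ≡ xs ++ [ x ]
  take-∷ʳ zero    xs       x = inj₁ ≡.refl
  take-∷ʳ (suc k) []       x = inj₂ (cong (x ∷_) (List.take-[] k))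
  take-∷ʳ (suc k) (y ∷ xs) x = Sum.map (cong (y ∷_)) (cong (y ∷_)) (take-∷ʳ k xs x)

  full-sum-bound : ∀ {n} δ W → d ℕ.≤ n → Balanced n (fromℕ (n ℕ.∸ d)) W → VectorsBounded δ (vectors W) →
    Bounded (fromℕ d * δ) (sumᵥ (vectors W))
  full-sum-bound {n} δ W d≤n B bounded =
    All.zipWith (λ {r} (p , z) → subst (λ x → ∣ x ∣ ≤ fromℕ d * δ) (≡.sym (sum≡ r z)) p)
      (subst (λ σ → Bounded (σ * δ) (slack-sum W)) slack≡d (slack-sum-bound δ W in-unit bounded) , balanced)
    where
    open Balanced B
    slack≡d : slack W ≡ fromℕ d
    slack≡d = ≡.trans (slack-of W length-eq weight (ℕ.m∸n≤m n d)) (cong fromℕ (ℕ.m∸[m∸n]≡n d≤n))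
    sum≡ : ∀ r → weighted-sum W r ≡ 0ℚ → sumᵥ (vectors W) r ≡ slack-sum W r
    sum≡ r z = ≡.trans (sumᵥ-vectors W r) (≡.trans (cong (slack-sum W r +_) z) (ℚ.+-identityʳ _))

  append-last : ∀ δ {W W′ a} → vectors W ↭ vectors W′ ++ [ a ] → Bounded δ (sumᵥ (vectors W)) →
    ∃ (λ P′ → P′ ↭ vectors W′ × PrefixBounded δ P′) → ∃ λ P → P ↭ vectors W × PrefixBounded δ P
  append-last δ {W} {W′} {a} split full (P′ , P′↭ , prefixes′) = P′ ++ [ a ] , P↭ , prefixes
    where
    P↭ : P′ ++ [ a ] ↭ vectors W
    P↭ = trans (Perm.++⁺ʳ [ a ] P′↭) (↭-sym split)
    prefixes : PrefixBounded δ (P′ ++ [ a ])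
    prefixes k with take-∷ʳ k P′ a
    ... | inj₁ e = subst (Bounded δ ∘ sumᵥ) (≡.sym e) (prefixes′ k)
    ... | inj₂ e = subst (Bounded δ ∘ sumᵥ) (≡.sym e)
                     (All.map (λ {r} b → subst (λ x → ∣ x ∣ ≤ δ) (≡.sym (sumᵥ-↭ P↭ r)) b) full)

  steinitz-balanced : ∀ n W δ → 0ℚ ≤ δ → Balanced n (fromℕ (n ℕ.∸ d)) W →
    VectorsBounded δ (vectors W) → ∃ λ P → P ↭ vectors W × PrefixBounded (fromℕ d * δ) P
  steinitz-balanced n W δ 0≤δ B bounded with n ℕ.≤? d
  ... | yes short = vectors W , refl , short-prefixes δ (vectors W) 0≤δ length≤d bounded
    where
    length≤d : length (vectors W) ℕ.≤ d
    length≤d = subst (ℕ._≤ d) (≡.sym (≡.trans (List.length-map proj₁ W) (Balanced.length-eq B))) short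
  steinitz-balanced zero    W δ 0≤δ B bounded | no long = ⊥-elim (long z≤n)
  steinitz-balanced (suc n) W δ 0≤δ B bounded | no long =
    let W′ , a , split , B′ = remove-one n W d≤n B
    in append-last (fromℕ d * δ) split (full-sum-bound δ W (ℕ.m≤n⇒m≤1+n d≤n) B bounded)
         (steinitz-balanced n W′ δ 0≤δ B′ (proj₁ (All.++⁻ (vectors W′) (Perm.All-resp-↭ split bounded))))
    where
    d≤n : d ℕ.≤ n
    d≤n = ℕ.≤-pred (ℕ.≰⇒> long)

  uniform : ℚ → List A → List Weighted
  uniform s = map (_, s)

  vectors-uniform : ∀ s as → vectors (uniform s as) ≡ as
  vectors-uniform s []       = ≡.refl
  vectors-uniform s (a ∷ as) = cong (a ∷_) (vectors-uniform s as)

  total-weight-uniform : ∀ s as → total-weight (uniform s as) ≡ s * fromℕ (length as)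
  total-weight-uniform s []       = ≡.sym (ℚ.*-zeroʳ s)
  total-weight-uniform s (a ∷ as) = begin
    s + total-weight (uniform s as)  ≡⟨ cong (s +_) (total-weight-uniform s as) ⟩
    s + s * fromℕ (length as)        ≡⟨ solve 2 (λ s n → s :+ s :* n := s :* (con 1ℚ :+ n)) ≡.refl
                                          s (fromℕ (length as)) ⟩
    s * (1ℚ + fromℕ (length as))     ≡⟨ cong (s *_) (≡.sym (fromℕ-suc (length as))) ⟩
    s * fromℕ (suc (length as))      ∎
    where open ≡.≡-Reasoning

  weighted-sum-uniform : ∀ s as r → weighted-sum (uniform s as) r ≡ s * sumᵥ as r
  weighted-sum-uniform s []       r = ≡.sym (ℚ.*-zeroʳ s)
  weighted-sum-uniform s (a ∷ as) r =
    ≡.trans (cong (s * vec a r +_) (weighted-sum-uniform s as r)) (≡.sym (ℚ.*-distribˡ-+ s (vec a r) (sumᵥ as r)))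

  steinitz : ∀ as δ → 0ℚ ≤ δ → VectorsBounded δ as → All (λ r → sumᵥ as r ≡ 0ℚ) rows →
    ∃ λ P → P ↭ as × PrefixBounded (fromℕ d * δ) P
  steinitz as δ 0≤δ bounded zero-sum with length as ℕ.≤? d
  ... | yes short = as , refl , short-prefixes δ as 0≤δ short bounded
  ... | no  long  = subst (λ bs → ∃ λ P → P ↭ bs × PrefixBounded (fromℕ d * δ) P) (vectors-uniform s as)
    (steinitz-balanced n W δ 0≤δ balanced (subst (VectorsBounded δ) (≡.sym (vectors-uniform s as)) bounded))
    where
    n : ℕ
    n = length as
    k : ℕ
    k = n ℕ.∸ d
    0<n : 0ℚ < fromℕ n
    0<n = fromℕ-pos (ℕ.≤-trans (s≤s z≤n) (ℕ.≰⇒> long))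
    instance
      n-nonZero : NonZero (fromℕ n)
      n-nonZero = ≢-nonZero λ n≡0 → ℚ.<-irrefl (≡.sym n≡0) 0<n
    s : ℚ
    s = fromℕ k ÷ fromℕ n
    s-in-unit : 0ℚ ≤ s × s ≤ 1ℚ
    s-in-unit = ÷-in-unit (fromℕ k) (fromℕ n) 0<n (fromℕ-nonNeg k) (fromℕ-mono-≤ (ℕ.m∸n≤m n d))
    W : List Weighted
    W = uniform s as
    balanced : Balanced n (fromℕ k) W
    balanced = record
      { length-eq = List.length-map _ as
      ; in-unit   = All.map⁺ (All.tabulate λ _ → s-in-unit)
      ; weight    = ≡.trans (total-weight-uniform s as) (÷-* (fromℕ k) (fromℕ n))
      ; balanced  = All.map (λ {r} z → ≡.trans (weighted-sum-uniform s as r)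
                                         (≡.trans (cong (s *_) z) (ℚ.*-zeroʳ s))) zero-sum
      }

module PrefixSumCollision {R : Set} (rows : List R) {T : Set} (column : T → R → ℤ) where
  open import Data.Integer as ℤ using (-[1+_]; ∣_∣)
  import Data.Integer.Properties as ℤ
  open import Data.Rational as ℚ using (ℚ; 0ℚ; 1ℚ; _+_; _*_; _-_; _÷_; NonZero; ≢-nonZero)
  import Data.Rational.Properties as ℚ
  open import Data.Rational.Literals using (fromℤ)
  open import Data.Rational.Solver using (module +-*-Solver)
  open +-*-Solver
  open import Data.List using ([]; _∷_; _++_; length; take; drop)
  import Data.List.Properties as List
  open import Data.List.Relation.Unary.All as All using (All; []; _∷_)
  open import Data.List.Relation.Binary.Permutation.Propositional using (_↭_; ↭-trans; ↭-sym)
  import Data.List.Relation.Binary.Permutation.Propositional.Properties as Perm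
  open import Data.Nat as ℕ using (ℕ; zero; suc; s≤s; z≤n; _≤_; _<_; _^_)
  import Data.Nat.Properties as ℕ
  open import Data.Fin as Fin using (Fin; toℕ; fromℕ<; combine)
  import Data.Fin.Properties as Fin
  open import Data.Product using (∃; _×_; _,_)
  open import Data.Empty using (⊥-elim)
  open import Function using (_∘_)
  open import Relation.Binary.PropositionalEquality

  open import Algebra.Properties.AbelianGroup ℤ.+-0-abelianGroup as ℤ+ using ()
  open RationalFacts

  d : ℕ
  d = length rows

  total : List T → R → ℤ
  total []      r = ℤ.+ 0
  total (t ∷ L) r = column t r ℤ.+ total L r

  total-++ : ∀ L L′ r → total (L ++ L′) r ≡ total L r ℤ.+ total L′ r
  total-++ []      L′ r = sym (ℤ.+-identityˡ _)
  total-++ (t ∷ L) L′ r =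
    trans (cong (λ z → column t r ℤ.+ z) (total-++ L L′ r)) (sym (ℤ.+-assoc (column t r) (total L r) (total L′ r)))

  VectorBounded : ℕ → (R → ℤ) → Set
  VectorBounded Δ v = All (λ r → ∣ v r ∣ ≤ Δ) rows

  PrefixBounded : ℕ → List T → Set
  PrefixBounded M P = ∀ k → VectorBounded M (total (take k P))

  zigzag : ℤ → ℕ
  zigzag (ℤ.+ n) = 2 ℕ.* n
  zigzag -[1+ n ] = suc (2 ℕ.* n)

  zigzag-injective : ∀ i j → zigzag i ≡ zigzag j → i ≡ j
  zigzag-injective (ℤ.+ m) (ℤ.+ n) e = cong ℤ.+_ (ℕ.*-cancelˡ-≡ m n 2 e)
  zigzag-injective (ℤ.+ m) -[1+ n ] e = ⊥-elim (ℕ.even≢odd m n e)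
  zigzag-injective -[1+ m ] (ℤ.+ n) e = ⊥-elim (ℕ.even≢odd n m (sym e))
  zigzag-injective -[1+ m ] -[1+ n ] e = cong -[1+_] (ℕ.*-cancelˡ-≡ m n 2 (ℕ.suc-injective e))

  zigzag-< : ∀ {M} z → ∣ z ∣ ≤ M → zigzag z < suc (2 ℕ.* M)
  zigzag-< (ℤ.+ n)  n≤M    = s≤s (ℕ.*-monoʳ-≤ 2 n≤M)
  zigzag-< -[1+ n ] 1+n≤M = ℕ.≤-trans (ℕ.n<1+n (suc (2 ℕ.* n)))
    (ℕ.≤-trans (ℕ.≤-reflexive (sym (ℕ.*-suc 2 n))) (ℕ.m≤n⇒m≤1+n (ℕ.*-monoʳ-≤ 2 1+n≤M)))

  encode : ∀ M rs (v : R → ℤ) → All (λ r → ∣ v r ∣ ≤ M) rs → Fin (suc (2 ℕ.* M) ^ length rs)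
  encode M []       v []       = Fin.zero
  encode M (r ∷ rs) v (b ∷ bs) = combine (fromℕ< (zigzag-< (v r) b)) (encode M rs v bs)

  encode-injective : ∀ M rs v w (bv : All (λ r → ∣ v r ∣ ≤ M) rs) (bw : All (λ r → ∣ w r ∣ ≤ M) rs) →
    encode M rs v bv ≡ encode M rs w bw → All (λ r → v r ≡ w r) rs
  encode-injective M []       v w []       []       _ = []
  encode-injective M (r ∷ rs) v w (b ∷ bs) (c ∷ cs) e with Fin.combine-injective _ _ _ _ e
  ... | same-digit , same-rest =
    zigzag-injective (v r) (w r) (Fin.fromℕ<-injective _ _ (zigzag-< (v r) b) (zigzag-< (w r) c) same-digit)
    ∷ encode-injective M rs v w bs cs same-rest

  module _ (L : List T) (b : R → ℤ) {{_ : NonZero (fromℕ (length L))}} where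

    private
      N : ℕ
      N = length L

    mean : R → ℚ
    mean r = fromℤ (b r) ÷ fromℕ N

    centered : T → R → ℚ
    centered t r = fromℤ (column t r) - mean r

    open Steinitz rows centered using (sumᵥ; steinitz)

    N*mean : ∀ r → fromℕ N * mean r ≡ fromℤ (b r)
    N*mean r = trans (ℚ.*-comm (fromℕ N) (mean r)) (÷-* (fromℤ (b r)) (fromℕ N))

    scaled-mean-bound : ∀ {k Δ} r → k ≤ N → ∣ b r ∣ ≤ Δ → ℚ.∣ fromℕ k * mean r ∣ ℚ.≤ fromℕ Δ
    scaled-mean-bound {k} {Δ} r k≤N ∣b∣≤Δ = begin
      ℚ.∣ fromℕ k * mean r ∣      ≡⟨ ℚ.∣p*q∣≡∣p∣*∣q∣ (fromℕ k) (mean r) ⟩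
      fromℕ k * ℚ.∣ mean r ∣      ≤⟨ *-monoʳ-≤-0≤ ℚ.∣ mean r ∣ (ℚ.0≤∣p∣ (mean r))
                                       (fromℕ-mono-≤ k≤N) ⟩
      fromℕ N * ℚ.∣ mean r ∣      ≡⟨ sym (ℚ.∣p*q∣≡∣p∣*∣q∣ (fromℕ N) (mean r)) ⟩
      ℚ.∣ fromℕ N * mean r ∣      ≡⟨ cong ℚ.∣_∣ (N*mean r) ⟩
      ℚ.∣ fromℤ (b r) ∣           ≤⟨ ∣fromℤ∣-mono-≤ (b r) ∣b∣≤Δ ⟩
      fromℕ Δ                     ∎
      where open ℚ.≤-Reasoning

    sumᵥ-centered : ∀ X r → sumᵥ X r ≡ fromℤ (total X r) - fromℕ (length X) * mean r
    sumᵥ-centered []      r = solve 1 (λ m → con 0ℚ := con 0ℚ :- con 0ℚ :* m) refl (mean r)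
    sumᵥ-centered (t ∷ X) r = trans (cong (centered t r +_) (sumᵥ-centered X r))
      (trans (solve 4 (λ c z m n → (c :- m) :+ (z :- n :* m) := (c :+ z) :- (con 1ℚ :+ n) :* m) refl
                (fromℤ (column t r)) (fromℤ (total X r)) (mean r) (fromℕ (length X)))
             (cong₂ (λ u k → u - k * mean r) (sym (fromℤ-+ (column t r) (total X r))) (sym (fromℕ-suc (length X)))))

    centered-sum : All (λ r → total L r ≡ b r) rows → All (λ r → sumᵥ L r ≡ 0ℚ) rows
    centered-sum = All.map λ {r} e → trans (sumᵥ-centered L r)
      (trans (cong₂ (λ u w → fromℤ u - w) e (N*mean r)) (ℚ.+-inverseʳ (fromℤ (b r))))

    centered-bounded : ∀ {Δ} → 1 ≤ N → All (VectorBounded Δ ∘ column) L → VectorBounded Δ b →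
      All (λ t → All (λ r → ℚ.∣ centered t r ∣ ℚ.≤ fromℕ (2 ℕ.* Δ)) rows) L
    centered-bounded {Δ} nonempty bounded b-bounded = All.map (λ {t} bt → All.zipWith (λ {r} (c , β) →
      ℚ.≤-trans (ℚ.∣p-q∣≤∣p∣+∣q∣ (fromℤ (column t r)) (mean r))
        (subst (ℚ.∣ fromℤ (column t r) ∣ + ℚ.∣ mean r ∣ ℚ.≤_) fromℕ-2*
          (ℚ.+-mono-≤ (∣fromℤ∣-mono-≤ (column t r) c) (∣mean∣≤ r β))))
      (bt , b-bounded)) bounded
      where
      ∣mean∣≤ : ∀ r → ∣ b r ∣ ≤ Δ → ℚ.∣ mean r ∣ ℚ.≤ fromℕ Δ
      ∣mean∣≤ r β = subst (λ x → ℚ.∣ x ∣ ℚ.≤ fromℕ Δ) (ℚ.*-identityˡ (mean r)) (scaled-mean-bound r nonempty β)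
      fromℕ-2* : fromℕ Δ + fromℕ Δ ≡ fromℕ (2 ℕ.* Δ)
      fromℕ-2* = trans (sym (fromℕ-+ Δ Δ)) (cong (λ x → fromℕ (Δ ℕ.+ x)) (sym (ℕ.+-identityʳ Δ)))

    -- The prefix totals are the centered prefix sums plus k times the mean, and |k mean| ≤ |b|.
    prefix-total-bound : ∀ {P Δ} → P ↭ L → ∀ k {r} →
      ℚ.∣ sumᵥ (take k P) r ∣ ℚ.≤ fromℕ d * fromℕ (2 ℕ.* Δ) × ∣ b r ∣ ≤ Δ →
      ∣ total (take k P) r ∣ ≤ d ℕ.* (2 ℕ.* Δ) ℕ.+ Δ
    prefix-total-bound {P} {Δ} P↭L k {r} (small , ∣b∣≤Δ) = ∣fromℤ∣-cancel-≤ (total X r) (begin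
      ℚ.∣ fromℤ (total X r) ∣                  ≡⟨ cong ℚ.∣_∣ total≡ ⟩
      ℚ.∣ sumᵥ X r + k·mean ∣                  ≤⟨ ℚ.∣p+q∣≤∣p∣+∣q∣ (sumᵥ X r) k·mean ⟩
      ℚ.∣ sumᵥ X r ∣ + ℚ.∣ k·mean ∣            ≤⟨ ℚ.+-mono-≤ small (scaled-mean-bound r length≤N ∣b∣≤Δ) ⟩
      fromℕ d * fromℕ (2 ℕ.* Δ) + fromℕ Δ      ≡⟨ cong (_+ fromℕ Δ) (sym (fromℕ-* d (2 ℕ.* Δ))) ⟩
      fromℕ (d ℕ.* (2 ℕ.* Δ)) + fromℕ Δ        ≡⟨ sym (fromℕ-+ (d ℕ.* (2 ℕ.* Δ)) Δ) ⟩
      fromℕ (d ℕ.* (2 ℕ.* Δ) ℕ.+ Δ)           ∎)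
      where
      open ℚ.≤-Reasoning
      X : List T
      X = take k P
      k·mean : ℚ
      k·mean = fromℕ (length X) * mean r
      total≡ : fromℤ (total X r) ≡ sumᵥ X r + k·mean
      total≡ = trans (solve 2 (λ z w → z := (z :- w) :+ w) refl (fromℤ (total X r)) k·mean)
                     (cong (_+ k·mean) (sym (sumᵥ-centered X r)))
      length≤N : length X ≤ N
      length≤N = subst (_≤ N) (sym (List.length-take k P))
                   (ℕ.≤-trans (ℕ.m⊓n≤n k (length P)) (ℕ.≤-reflexive (Perm.↭-length P↭L)))

  -- Subtracting the mean column b / N makes the columns sum to zero, so that the Steinitz
  -- lemma applies to them.
  bounded-order : ∀ L (b : R → ℤ) Δ → 1 ≤ length L → All (VectorBounded Δ ∘ column) L →
    VectorBounded Δ b → All (λ r → total L r ≡ b r) rows →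
    ∃ λ P → P ↭ L × PrefixBounded (d ℕ.* (2 ℕ.* Δ) ℕ.+ Δ) P
  bounded-order L b Δ nonempty bounded b-bounded sums =
    let P , P↭L , prefixes = steinitz L (fromℕ (2 ℕ.* Δ)) (fromℕ-nonNeg _)
                               (centered-bounded L b nonempty bounded b-bounded) (centered-sum L b sums)
    in P , P↭L , λ k → All.zipWith (prefix-total-bound L b P↭L k) (prefixes k , b-bounded)
    where
    instance
      N-nonZero : NonZero (fromℕ (length L))
      N-nonZero = ≢-nonZero λ N≡0 → ℚ.<-irrefl (sym N≡0) (fromℕ-pos nonempty)
    open Steinitz rows (centered L b) using (steinitz)

  repeated-prefix : ∀ M P → PrefixBounded M P → suc (2 ℕ.* M) ^ d < length P →
    ∃ λ i → ∃ λ j → i < j × j < length P × All (λ r → total (take i P) r ≡ total (take j P) r) rows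
  repeated-prefix M P bounded long =
    let i , j , i<j , same-code = Fin.pigeonhole long code
    in toℕ i , toℕ j , i<j , Fin.toℕ<n j ,
       encode-injective M rows _ _ (bounded (toℕ i)) (bounded (toℕ j)) same-code
    where
    code : Fin (length P) → Fin (suc (2 ℕ.* M) ^ d)
    code k = encode M rows (total (take (toℕ k) P)) (bounded (toℕ k))

  record ZeroSplit (L : List T) : Set where
    field
      zero-part          : List T
      rest               : List T
      split              : L ↭ zero-part ++ rest
      zero-part-nonempty : zero-part ≢ []
      rest-nonempty      : rest ≢ []
      zero-total         : All (λ r → total zero-part r ≡ ℤ.+ 0) rows

  segment-split : ∀ P i j → i < j → j < length P →
    All (λ r → total (take i P) r ≡ total (take j P) r) rows → ZeroSplit P
  segment-split P i j i<j j<P same = record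
    { zero-part          = S
    ; rest               = take i P ++ drop j P
    ; split              = subst (_↭ S ++ take i P ++ drop j P) (sym P≡) (Perm.shifts (take i P) S)
    ; zero-part-nonempty = λ S≡[] → ℕ.<⇒≱ i<j (ℕ.m∸n≡0⇒m≤n (trans (cong (ℕ._∸ i) (sym length-take-j))
                             (trans (sym (List.length-drop i (take j P))) (cong length S≡[]))))
    ; rest-nonempty      = λ R≡[] → ℕ.<⇒≱ j<P (ℕ.m∸n≡0⇒m≤n (trans (sym (List.length-drop j P))
                             (cong length (List.++-conicalʳ (take i P) (drop j P) R≡[]))))
    ; zero-total         = All.map (λ {r} e → ℤ+.identityʳ-unique (total (take i P) r) (total S r)
                             (trans (sym (total-++ (take i P) S r)) (trans (total-take-j r) (sym e)))) same
    }
    where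
    S : List T
    S = drop i (take j P)
    take-j≡ : take j P ≡ take i P ++ S
    take-j≡ = trans (sym (List.take++drop≡id i (take j P)))
      (cong (_++ S) (trans (List.take-take i j P) (cong (λ n → take n P) (ℕ.m≤n⇒m⊓n≡m (ℕ.<⇒≤ i<j)))))
    total-take-j : ∀ r → total (take i P ++ S) r ≡ total (take j P) r
    total-take-j r = cong (λ X → total X r) (sym take-j≡)
    P≡ : P ≡ take i P ++ S ++ drop j P
    P≡ = trans (sym (List.take++drop≡id j P))
      (trans (cong (_++ drop j P) take-j≡) (List.++-assoc (take i P) S (drop j P)))
    length-take-j : length (take j P) ≡ j
    length-take-j = trans (List.length-take j P) (ℕ.m≤n⇒m⊓n≡m (ℕ.<⇒≤ j<P))

  collision-bound : ℕ → ℕ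
  collision-bound Δ = suc (2 ℕ.* (d ℕ.* (2 ℕ.* Δ) ℕ.+ Δ)) ^ d

  -- Order the columns with small prefix totals; among more prefixes than there are small
  -- integer vectors two totals coincide, and the columns in between total zero.
  collision : ∀ L (b : R → ℤ) Δ → All (VectorBounded Δ ∘ column) L → VectorBounded Δ b →
    All (λ r → total L r ≡ b r) rows → collision-bound Δ < length L → ZeroSplit L
  collision L b Δ bounded b-bounded sums long =
    let P , P↭L , prefixes = bounded-order L b Δ (ℕ.≤-trans (s≤s z≤n) long) bounded b-bounded sums
        i , j , i<j , j<P , same =
          repeated-prefix _ P prefixes (subst (collision-bound Δ <_) (sym (Perm.↭-length P↭L)) long)
        open ZeroSplit (segment-split P i j i<j j<P same)
    in record
      { zero-part = zero-part ; rest = rest ; split = ↭-trans (↭-sym P↭L) split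
      ; zero-part-nonempty = zero-part-nonempty ; rest-nonempty = rest-nonempty ; zero-total = zero-total }

module FiniteSums where
  open import Defs using (Σℕ; Σℤ)
  open import Data.Nat as ℕ using (ℕ; zero; suc; z≤n; _+_; _*_; _≤_)
  import Data.Nat.Properties as ℕ
  import Data.Nat.Solver as ℕ-Solver
  open import Data.Integer as ℤ using (ℤ)
  import Data.Integer.Properties as ℤ
  import Data.Integer.Solver as ℤ-Solver
  open import Data.Fin using (Fin; zero; suc)
  import Data.Fin.Properties as Fin
  open import Data.List using (List; []; _++_)
  open import Data.List.Membership.Propositional using (_∈_)
  import Data.List.Membership.Propositional.Properties as ∈
  open import Data.Product using (_×_; _,_)
  open import Function using (_∘_)
  open import Relation.Binary.PropositionalEquality

  Σℕ-cong : ∀ n {f g : Fin n → ℕ} → (∀ i → f i ≡ g i) → Σℕ n f ≡ Σℕ n g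
  Σℕ-cong zero    f≗g = refl
  Σℕ-cong (suc n) f≗g = cong₂ _+_ (f≗g zero) (Σℕ-cong n (f≗g ∘ suc))

  Σℕ-+ : ∀ n (f g : Fin n → ℕ) → Σℕ n (λ i → f i + g i) ≡ Σℕ n f + Σℕ n g
  Σℕ-+ zero    f g = refl
  Σℕ-+ (suc n) f g = trans (cong (f zero + g zero +_) (Σℕ-+ n (f ∘ suc) (g ∘ suc)))
    (solve 4 (λ a b c d → (a :+ b) :+ (c :+ d) := (a :+ c) :+ (b :+ d)) refl
       (f zero) (g zero) (Σℕ n (f ∘ suc)) (Σℕ n (g ∘ suc)))
    where open ℕ-Solver.+-*-Solver

  Σℕ-zero : ∀ n {f : Fin n → ℕ} → (∀ i → f i ≡ 0) → Σℕ n f ≡ 0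
  Σℕ-zero zero    f≗0 = refl
  Σℕ-zero (suc n) f≗0 = cong₂ _+_ (f≗0 zero) (Σℕ-zero n (f≗0 ∘ suc))

  Σℕ-single : ∀ n {f : Fin n → ℕ} i → (∀ j → j ≢ i → f j ≡ 0) → Σℕ n f ≡ f i
  Σℕ-single (suc n) {f} zero    off =
    trans (cong (f zero +_) (Σℕ-zero n λ j → off (suc j) λ ())) (ℕ.+-identityʳ (f zero))
  Σℕ-single (suc n)     (suc i) off =
    cong₂ _+_ (off zero λ ()) (Σℕ-single n i λ j j≢i → off (suc j) (j≢i ∘ Fin.suc-injective))

  Σℕ-term : ∀ n (f : Fin n → ℕ) i → f i ≤ Σℕ n f
  Σℕ-term (suc n) f zero    = ℕ.m≤m+n (f zero) _
  Σℕ-term (suc n) f (suc i) = ℕ.≤-trans (Σℕ-term n (f ∘ suc) i) (ℕ.m≤n+m _ (f zero))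

  Σℕ-mono : ∀ n {f g : Fin n → ℕ} → (∀ i → f i ≤ g i) → Σℕ n f ≤ Σℕ n g
  Σℕ-mono zero    f≤g = z≤n
  Σℕ-mono (suc n) f≤g = ℕ.+-mono-≤ (f≤g zero) (Σℕ-mono n (f≤g ∘ suc))

  Σℕ-const : ∀ n c → Σℕ n (λ _ → c) ≡ n * c
  Σℕ-const zero    c = refl
  Σℕ-const (suc n) c = cong (c +_) (Σℕ-const n c)

  Σℤ-cong : ∀ n {f g : Fin n → ℤ} → (∀ i → f i ≡ g i) → Σℤ n f ≡ Σℤ n g
  Σℤ-cong zero    f≗g = refl
  Σℤ-cong (suc n) f≗g = cong₂ ℤ._+_ (f≗g zero) (Σℤ-cong n (f≗g ∘ suc))

  Σℤ-+ : ∀ n (f g : Fin n → ℤ) → Σℤ n (λ i → f i ℤ.+ g i) ≡ Σℤ n f ℤ.+ Σℤ n g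
  Σℤ-+ zero    f g = refl
  Σℤ-+ (suc n) f g = trans (cong (λ s → f zero ℤ.+ g zero ℤ.+ s) (Σℤ-+ n (f ∘ suc) (g ∘ suc)))
    (solve 4 (λ a b c d → (a :+ b) :+ (c :+ d) := (a :+ c) :+ (b :+ d)) refl
       (f zero) (g zero) (Σℤ n (f ∘ suc)) (Σℤ n (g ∘ suc)))
    where open ℤ-Solver.+-*-Solver

  Σℤ-linear : ∀ n (u v : Fin n → ℕ) (c : Fin n → ℤ) →
    Σℤ n (λ i → ℤ.+ (u i + v i) ℤ.* c i) ≡ Σℤ n (λ i → ℤ.+ u i ℤ.* c i) ℤ.+ Σℤ n (λ i → ℤ.+ v i ℤ.* c i)
  Σℤ-linear n u v c = trans
    (Σℤ-cong n λ i → trans (cong (ℤ._* c i) (ℤ.pos-+ (u i) (v i))) (ℤ.*-distribʳ-+ (c i) (ℤ.+ u i) (ℤ.+ v i)))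
    (Σℤ-+ n (λ i → ℤ.+ u i ℤ.* c i) (λ i → ℤ.+ v i ℤ.* c i))

  Σℤ-zero : ∀ n {f : Fin n → ℤ} → (∀ i → f i ≡ ℤ.+ 0) → Σℤ n f ≡ ℤ.+ 0
  Σℤ-zero zero    f≗0 = refl
  Σℤ-zero (suc n) f≗0 = cong₂ ℤ._+_ (f≗0 zero) (Σℤ-zero n (f≗0 ∘ suc))

  Σℤ-scaled-bound : ∀ n (u : Fin n → ℕ) (c : Fin n → ℤ) {L} → (∀ i → ℤ.∣ c i ∣ ≤ L) →
    ℤ.∣ Σℤ n (λ i → ℤ.+ u i ℤ.* c i) ∣ ≤ Σℕ n u * L
  Σℤ-scaled-bound zero    u c c≤L = z≤n
  Σℤ-scaled-bound (suc n) u c {L} c≤L = begin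
    ℤ.∣ first ℤ.+ rest ∣                  ≤⟨ ℤ.∣i+j∣≤∣i∣+∣j∣ first rest ⟩
    ℤ.∣ first ∣ + ℤ.∣ rest ∣              ≡⟨ cong (_+ ℤ.∣ rest ∣) (ℤ.∣i*j∣≡∣i∣*∣j∣ (ℤ.+ u zero) (c zero)) ⟩
    u zero * ℤ.∣ c zero ∣ + ℤ.∣ rest ∣    ≤⟨ ℕ.+-mono-≤ (ℕ.*-monoʳ-≤ (u zero) (c≤L zero))
                                               (Σℤ-scaled-bound n (u ∘ suc) (c ∘ suc) (c≤L ∘ suc)) ⟩
    u zero * L + Σℕ n (u ∘ suc) * L      ≡⟨ sym (ℕ.*-distribʳ-+ L (u zero) (Σℕ n (u ∘ suc))) ⟩
    Σℕ (suc n) u * L                     ∎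
    where
    open ℕ.≤-Reasoning
    first rest : ℤ
    first = ℤ.+ u zero ℤ.* c zero
    rest  = Σℤ n (λ i → ℤ.+ u (suc i) ℤ.* c (suc i))

  concatF : ∀ {A : Set} n → (Fin n → List A) → List A
  concatF zero    g = []
  concatF (suc n) g = g zero ++ concatF n (g ∘ suc)

  ∈-concatF : ∀ {A : Set} n (g : Fin n → List A) i {v} → v ∈ g i → v ∈ concatF n g
  ∈-concatF (suc n) g zero    v∈ = ∈.∈-++⁺ˡ v∈
  ∈-concatF (suc n) g (suc i) v∈ = ∈.∈-++⁺ʳ (g zero) (∈-concatF n (g ∘ suc) i v∈)

  Additive : ∀ {A : Set} → (List A → ℕ) → Set
  Additive h = h [] ≡ 0 × ∀ xs ys → h (xs ++ ys) ≡ h xs + h ys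

  additive-concatF : ∀ {A : Set} (h : List A → ℕ) → Additive h → ∀ n g → h (concatF n g) ≡ Σℕ n (h ∘ g)
  additive-concatF h (h[] , _)   zero    g = h[]
  additive-concatF h (h[] , h++) (suc n) g =
    trans (h++ (g zero) _) (cong (h (g zero) +_) (additive-concatF h (h[] , h++) n (g ∘ suc)))

module CharacteristicSystem {D : ℕ} (ξ : CGS D) where
  open import Defs

  open import Data.Nat as ℕ using (zero; suc; z≤n; s≤s; _+_; _*_; _≤_; _<_)
  import Data.Nat.Properties as ℕ
  open import Data.Nat.ListAction using (sum)
  import Data.Nat.ListAction.Properties as ℕ
  open import Data.Integer as ℤ using (ℤ)
  import Data.Integer.Properties as ℤ
  open import Data.Fin as Fin using (Fin; inject₁; fromℕ)
  open import Data.List as List using (List; []; _∷_; _++_; [_]; length; replicate; map)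
  import Data.List.Properties as List
  open import Data.List.Relation.Unary.Any using (here)
  open import Data.List.Membership.Propositional using (_∈_)
  import Data.List.Membership.Propositional.Properties as ∈
  open import Data.List.Relation.Binary.Permutation.Propositional using (_↭_)
  import Data.List.Relation.Binary.Permutation.Propositional.Properties as Perm
  open import Data.Product as Σ using (Σ; _,_; proj₁; proj₂)
  import Data.Product.Properties as Σ
  open import Data.Sum as Sum using (_⊎_; inj₁; inj₂)
  open import Data.Bool using (true; false; if_then_else_)
  import Data.Sum.Properties as Sum
  open import Data.Empty using (⊥-elim)
  open import Function using (_∘_)
  open import Relation.Nullary using (Dec; yes; no; ¬_)
  open import Relation.Nullary.Decidable using (⌊_⌋)
  open import Relation.Binary using (DecidableEquality)
  open import Relation.Binary.PropositionalEquality hiding ([_])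

  open FiniteSums
  import Data.Integer.Solver as ℤ-Solver
  import Data.Nat.Solver as ℕ-Solver

  K : ℕ
  K = k ξ

  Block : Set
  Block = Fin (suc K)

  Slot : Block → Set
  Slot j = (Fin D ⊎ Fin D) ⊎ Fin (nT' ξ j)

  Var : Set
  Var = Σ Block Slot

  pattern xVar j i = j , inj₁ (inj₁ i)
  pattern yVar j i = j , inj₁ (inj₂ i)
  pattern ψVar j e = j , inj₂ e

  value : Assign ξ → Var → ℕ
  value m (xVar j i) = x m j i
  value m (yVar j i) = y m j i
  value m (ψVar j e) = Ψ m j e

  assignment : (Var → ℕ) → Assign ξ
  assignment f = record { x = λ j i → f (xVar j i) ; y = λ j i → f (yVar j i) ; Ψ = λ j e → f (ψVar j e) }

  value-assignment : ∀ (f : Var → ℕ) t → value (assignment f) t ≡ f t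
  value-assignment f (xVar j i) = refl
  value-assignment f (yVar j i) = refl
  value-assignment f (ψVar j e) = refl

  _≟ᵛ_ : DecidableEquality Var
  _≟ᵛ_ = Σ.≡-dec Fin._≟_ (Sum.≡-dec (Sum.≡-dec Fin._≟_ Fin._≟_) Fin._≟_)

  infix 4 _≈_
  _≈_ : Assign ξ → Assign ξ → Set
  m ≈ m′ = ∀ t → value m t ≡ value m′ t

  infixl 6 _⊕_
  _⊕_ : Assign ξ → Assign ξ → Assign ξ
  m ⊕ m′ = assignment λ t → value m t + value m′ t

  value-⊕ : ∀ m m′ t → value (m ⊕ m′) t ≡ value m t + value m′ t
  value-⊕ m m′ = value-assignment λ t → value m t + value m′ t

  ≼-from-≤ : ∀ {m m′} → (∀ t → value m t ≤ value m′ t) → m ≼ m′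
  ≼-from-≤ m≤m′ = (λ j i → m≤m′ (xVar j i)) , (λ j i → m≤m′ (yVar j i)) ,
                  (λ j e → m≤m′ (ψVar j e))

  ≼-to-≤ : ∀ {m m′} → m ≼ m′ → ∀ t → value m t ≤ value m′ t
  ≼-to-≤ (x≤ , y≤ , Ψ≤) (xVar j i) = x≤ j i
  ≼-to-≤ (x≤ , y≤ , Ψ≤) (yVar j i) = y≤ j i
  ≼-to-≤ (x≤ , y≤ , Ψ≤) (ψVar j e) = Ψ≤ j e

  -- Σᵥ (value m) is norm1 m by definition.
  Σ-block : (Var → ℕ) → Block → ℕ
  Σ-block f j = Σℕ D (f ∘ xVar j) + Σℕ D (f ∘ yVar j) + Σℕ (nT' ξ j) (f ∘ ψVar j)

  Σᵥ : (Var → ℕ) → ℕ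
  Σᵥ f = Σℕ (suc K) (Σ-block f)

  Σᵥ-cong : ∀ (f g : Var → ℕ) → (∀ t → f t ≡ g t) → Σᵥ f ≡ Σᵥ g
  Σᵥ-cong f g f≗g = Σℕ-cong (suc K) λ j → cong₂ _+_
    (cong₂ _+_ (Σℕ-cong D (f≗g ∘ xVar j)) (Σℕ-cong D (f≗g ∘ yVar j)))
    (Σℕ-cong (nT' ξ j) (f≗g ∘ ψVar j))

  Σᵥ-mono : ∀ (f g : Var → ℕ) → (∀ t → f t ≤ g t) → Σᵥ f ≤ Σᵥ g
  Σᵥ-mono f g f≤g = Σℕ-mono (suc K) λ j → ℕ.+-mono-≤
    (ℕ.+-mono-≤ (Σℕ-mono D (f≤g ∘ xVar j)) (Σℕ-mono D (f≤g ∘ yVar j)))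
    (Σℕ-mono (nT' ξ j) (f≤g ∘ ψVar j))

  Σᵥ-+ : ∀ (f g : Var → ℕ) → Σᵥ (λ t → f t + g t) ≡ Σᵥ f + Σᵥ g
  Σᵥ-+ f g = trans (Σℕ-cong (suc K) block) (Σℕ-+ (suc K) (Σ-block f) (Σ-block g))
    where
    open ℕ-Solver.+-*-Solver
    block : ∀ j → Σ-block (λ t → f t + g t) j ≡ Σ-block f j + Σ-block g j
    block j = trans
      (cong₂ _+_ (cong₂ _+_ (Σℕ-+ D (f ∘ xVar j) (g ∘ xVar j)) (Σℕ-+ D (f ∘ yVar j) (g ∘ yVar j)))
                 (Σℕ-+ (nT' ξ j) (f ∘ ψVar j) (g ∘ ψVar j)))
      (solve 6 (λ a b c d e h → (a :+ b) :+ (c :+ d) :+ (e :+ h) := (a :+ c :+ e) :+ (b :+ d :+ h)) refl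
         (Σℕ D (f ∘ xVar j)) (Σℕ D (g ∘ xVar j)) (Σℕ D (f ∘ yVar j)) (Σℕ D (g ∘ yVar j))
         (Σℕ (nT' ξ j) (f ∘ ψVar j)) (Σℕ (nT' ξ j) (g ∘ ψVar j)))

  Σᵥ-single : ∀ (g : Var → ℕ) t → (∀ u → u ≢ t → g u ≡ 0) → Σᵥ g ≡ g t
  Σᵥ-single g (j₀ , s₀) off = trans (Σℕ-single (suc K) j₀ other-block) (this-block s₀ off)
    where
    other-block : ∀ j → j ≢ j₀ → Σ-block g j ≡ 0
    other-block j j≢j₀ = cong₂ _+_ (cong₂ _+_ (Σℕ-zero D λ _ → elsewhere) (Σℕ-zero D λ _ → elsewhere))
                                   (Σℕ-zero (nT' ξ j) λ _ → elsewhere)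
      where
      elsewhere : ∀ {s} → g (j , s) ≡ 0
      elsewhere = off _ (j≢j₀ ∘ cong proj₁)
    this-block : ∀ s → (∀ u → u ≢ (j₀ , s) → g u ≡ 0) → Σ-block g j₀ ≡ g (j₀ , s)
    this-block (inj₁ (inj₁ i₀)) off = trans (cong₂ _+_
      (cong₂ _+_ (Σℕ-single D i₀ λ i i≢i₀ → off _ λ { refl → i≢i₀ refl })
                 (Σℕ-zero D λ i → off _ λ ()))
      (Σℕ-zero (nT' ξ j₀) λ e → off _ λ ())) (trans (ℕ.+-identityʳ _) (ℕ.+-identityʳ _))
    this-block (inj₁ (inj₂ i₀)) off = trans (cong₂ _+_
      (cong₂ _+_ (Σℕ-zero D λ i → off _ λ ())
                 (Σℕ-single D i₀ λ i i≢i₀ → off _ λ { refl → i≢i₀ refl }))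
      (Σℕ-zero (nT' ξ j₀) λ e → off _ λ ())) (ℕ.+-identityʳ _)
    this-block (inj₂ e₀) off = cong₂ _+_
      (cong₂ _+_ (Σℕ-zero D λ i → off _ λ ()) (Σℕ-zero D λ i → off _ λ ()))
      (Σℕ-single (nT' ξ j₀) e₀ λ e e≢e₀ → off _ λ { refl → e≢e₀ refl })

  concat-block : ∀ {A : Set} → (Var → List A) → Block → List A
  concat-block g j = (concatF D (g ∘ xVar j) ++ concatF D (g ∘ yVar j)) ++ concatF (nT' ξ j) (g ∘ ψVar j)

  concatᵥ : ∀ {A : Set} → (Var → List A) → List A
  concatᵥ g = concatF (suc K) (concat-block g)

  additive-concatᵥ : ∀ {A : Set} (h : List A → ℕ) → Additive h → ∀ g → h (concatᵥ g) ≡ Σᵥ (h ∘ g)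
  additive-concatᵥ h additive@(_ , h++) g =
    trans (additive-concatF h additive (suc K) (concat-block g)) (Σℕ-cong (suc K) λ j →
      trans (h++ (concatF D (g ∘ xVar j) ++ concatF D (g ∘ yVar j)) _)
        (cong₂ _+_ (trans (h++ (concatF D (g ∘ xVar j)) _)
                          (cong₂ _+_ (additive-concatF h additive D (g ∘ xVar j))
                                     (additive-concatF h additive D (g ∘ yVar j))))
                   (additive-concatF h additive (nT' ξ j) (g ∘ ψVar j))))

  𝟙 : ∀ {P : Set} → Dec P → ℕ
  𝟙 (yes _) = 1
  𝟙 (no  _) = 0

  𝟙-yes : ∀ {P : Set} (d : Dec P) → P → 𝟙 d ≡ 1
  𝟙-yes (yes _) _  = refl
  𝟙-yes (no ¬p) p = ⊥-elim (¬p p)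

  𝟙-no : ∀ {P : Set} (d : Dec P) → ¬ P → 𝟙 d ≡ 0
  𝟙-no (yes p) ¬p = ⊥-elim (¬p p)
  𝟙-no (no _)  _  = refl

  Σᵥ-sift : ∀ (f : Var → ℕ) t → Σᵥ (λ u → f u * 𝟙 (u ≟ᵛ t)) ≡ f t
  Σᵥ-sift f t = trans
    (Σᵥ-single (λ u → f u * 𝟙 (u ≟ᵛ t)) t λ u u≢t →
      trans (cong (f u *_) (𝟙-no (u ≟ᵛ t) u≢t)) (ℕ.*-zeroʳ (f u)))
    (trans (cong (f t *_) (𝟙-yes (t ≟ᵛ t) refl)) (ℕ.*-identityʳ (f t)))

  value≤norm1 : ∀ m t → value m t ≤ norm1 m
  value≤norm1 m t = subst (_≤ norm1 m) (Σᵥ-sift (value m) t)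
    (Σᵥ-mono (λ u → value m u * 𝟙 (u ≟ᵛ t)) (value m) λ u →
      ℕ.≤-trans (ℕ.*-monoʳ-≤ (value m u) (𝟙≤1 (u ≟ᵛ t))) (ℕ.≤-reflexive (ℕ.*-identityʳ (value m u))))
    where
    𝟙≤1 : ∀ {P : Set} (d : Dec P) → 𝟙 d ≤ 1
    𝟙≤1 (yes _) = s≤s z≤n
    𝟙≤1 (no  _) = z≤n

  norm1-⊕ : ∀ m m′ → norm1 (m ⊕ m′) ≡ norm1 m + norm1 m′
  norm1-⊕ m m′ = trans (Σᵥ-cong _ _ (value-⊕ m m′)) (Σᵥ-+ (value m) (value m′))

  norm1-cong : ∀ {m m′} → m ≈ m′ → norm1 m ≡ norm1 m′
  norm1-cong {m} {m′} = Σᵥ-cong (value m) (value m′)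

  occurrences : Var → List Var → ℕ
  occurrences t = sum ∘ map λ u → 𝟙 (u ≟ᵛ t)

  occurrences-additive : ∀ t → Additive (occurrences t)
  occurrences-additive t = refl , λ S S′ →
    trans (cong sum (List.map-++ ind S S′)) (ℕ.sum-++ (map ind S) (map ind S′))
    where
    ind : Var → ℕ
    ind u = 𝟙 (u ≟ᵛ t)

  tally : List Var → Assign ξ
  tally S = assignment λ t → occurrences t S

  value-tally : ∀ S t → value (tally S) t ≡ occurrences t S
  value-tally S = value-assignment λ t → occurrences t S

  tally-++ : ∀ S S′ → tally (S ++ S′) ≈ tally S ⊕ tally S′
  tally-++ S S′ t = begin
    value (tally (S ++ S′)) t                  ≡⟨ value-tally (S ++ S′) t ⟩
    occurrences t (S ++ S′)                    ≡⟨ proj₂ (occurrences-additive t) S S′ ⟩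
    occurrences t S + occurrences t S′         ≡⟨ sym (cong₂ _+_ (value-tally S t) (value-tally S′ t)) ⟩
    value (tally S) t + value (tally S′) t     ≡⟨ sym (value-⊕ (tally S) (tally S′) t) ⟩
    value (tally S ⊕ tally S′) t               ∎
    where open ≡-Reasoning

  tally-↭ : ∀ {S S′} → S ↭ S′ → tally S ≈ tally S′
  tally-↭ {S} {S′} S↭S′ t =
    trans (value-tally S t) (trans (ℕ.sum-↭ (Perm.map⁺ _ S↭S′)) (sym (value-tally S′ t)))

  tally-∷-positive : ∀ t S → 0 < value (tally (t ∷ S)) t
  tally-∷-positive t S = subst (0 <_)
    (sym (trans (value-tally (t ∷ S) t) (cong (_+ occurrences t S) (𝟙-yes (t ≟ᵛ t) refl)))) (s≤s z≤n)

  norm1-tally-singleton : ∀ t → norm1 (tally [ t ]) ≡ 1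
  norm1-tally-singleton t = trans
    (Σᵥ-single (value (tally [ t ])) t λ u u≢t →
      trans (value-tally [ t ] u) (cong (_+ 0) (𝟙-no (t ≟ᵛ u) (u≢t ∘ sym))))
    (trans (value-tally [ t ] t) (cong (_+ 0) (𝟙-yes (t ≟ᵛ t) refl)))

  length-additive : ∀ {A : Set} → Additive (length {A = A})
  length-additive = refl , λ xs ys → List.length-++ xs

  tokens : Assign ξ → List Var
  tokens m = concatᵥ λ t → replicate (value m t) t

  length-tokens : ∀ m → length (tokens m) ≡ norm1 m
  length-tokens m = trans (additive-concatᵥ length length-additive (λ t → replicate (value m t) t))
    (Σᵥ-cong _ (value m) λ t → List.length-replicate (value m t) {t})

  tally-tokens : ∀ m → tally (tokens m) ≈ m
  tally-tokens m t = trans (value-tally (tokens m) t)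
    (trans (additive-concatᵥ (occurrences t) (occurrences-additive t) (λ u → replicate (value m u) u))
           (trans (Σᵥ-cong _ (λ u → value m u * 𝟙 (u ≟ᵛ t)) occurrences-replicate) (Σᵥ-sift (value m) t)))
    where
    occurrences-replicate : ∀ u → occurrences t (replicate (value m u) u) ≡ value m u * 𝟙 (u ≟ᵛ t)
    occurrences-replicate u = trans (cong sum (List.map-replicate (λ v → 𝟙 (v ≟ᵛ t)) (value m u) u))
                                    (sum-replicate (value m u))
      where
      sum-replicate : ∀ n → sum (replicate n (𝟙 (u ≟ᵛ t))) ≡ n * 𝟙 (u ≟ᵛ t)
      sum-replicate zero    = refl
      sum-replicate (suc n) = cong (𝟙 (u ≟ᵛ t) +_) (sum-replicate n)

  data Row : Set where
    kirchhoff : (j : Block) → Fin (nQ (G (comp ξ j))) → Row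
    effect    : Block → Fin D → Row
    connect   : Fin K → Fin D → Row
    start end : Fin D → Row

  -- Each equation with its variables moved to the left-hand side.
  lhs : Row → Assign ξ → ℤ
  lhs (kirchhoff j o) m = flow ξ m j o
  lhs (effect j i)    m = (ℤ.+ x m j i ℤ.+ Δ ξ m j i) ℤ.- ℤ.+ y m j i
  lhs (connect j i)   m = ℤ.+ x m (Fin.suc j) i ℤ.- ℤ.+ y m (inject₁ j) i
  lhs (start i)       m = ℤ.+ x m Fin.zero i
  lhs (end i)         m = ℤ.+ y m (fromℕ K) i

  rhs : (Fin D → ℕ) → (Fin D → ℕ) → Row → ℤ
  rhs a b (kirchhoff j o) = 𝟏 (q (comp ξ j)) o ℤ.- 𝟏 (p (comp ξ j)) o
  rhs a b (effect j i)    = ℤ.+ 0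
  rhs a b (connect j i)   = conn ξ j i
  rhs a b (start i)       = ℤ.+ a i
  rhs a b (end i)         = ℤ.+ b i

  lhs-cong : ∀ r {m m′} → m ≈ m′ → lhs r m ≡ lhs r m′
  lhs-cong (kirchhoff j o) m≈m′ = Σℤ-cong (nT' ξ j) λ e → cong (λ n → ℤ.+ n ℤ.* _) (m≈m′ (ψVar j e))
  lhs-cong (effect j i)    m≈m′ = cong₂ ℤ._-_
    (cong₂ ℤ._+_ (cong ℤ.+_ (m≈m′ (xVar j i))) (Σℤ-cong (nT' ξ j) λ e → cong (λ n → ℤ.+ n ℤ.* _) (m≈m′ (ψVar j e))))
    (cong ℤ.+_ (m≈m′ (yVar j i)))
  lhs-cong (connect j i)   m≈m′ =
    cong₂ ℤ._-_ (cong ℤ.+_ (m≈m′ (xVar (Fin.suc j) i))) (cong ℤ.+_ (m≈m′ (yVar (inject₁ j) i)))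
  lhs-cong (start i)       m≈m′ = cong ℤ.+_ (m≈m′ (xVar Fin.zero i))
  lhs-cong (end i)         m≈m′ = cong ℤ.+_ (m≈m′ (yVar (fromℕ K) i))

  lhs-⊕ : ∀ r m m′ → lhs r (m ⊕ m′) ≡ lhs r m ℤ.+ lhs r m′
  lhs-⊕ (kirchhoff j o) m m′ = Σℤ-linear (nT' ξ j) (Ψ m j) (Ψ m′ j) _
  lhs-⊕ (effect j i)    m m′ = trans
    (cong₂ (λ u w → (u ℤ.+ w) ℤ.- ℤ.+ (y m j i + y m′ j i))
           (ℤ.pos-+ (x m j i) (x m′ j i)) (Σℤ-linear (nT' ξ j) (Ψ m j) (Ψ m′ j) _))
    (trans (cong (λ w → (ℤ.+ x m j i ℤ.+ ℤ.+ x m′ j i ℤ.+ (Δ ξ m j i ℤ.+ Δ ξ m′ j i)) ℤ.- w)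
                 (ℤ.pos-+ (y m j i) (y m′ j i)))
      (solve 6 (λ a b c d e f → (a :+ b :+ (c :+ d)) :- (e :+ f) := ((a :+ c) :- e) :+ ((b :+ d) :- f)) refl
         (ℤ.+ x m j i) (ℤ.+ x m′ j i) (Δ ξ m j i) (Δ ξ m′ j i) (ℤ.+ y m j i) (ℤ.+ y m′ j i)))
    where open ℤ-Solver.+-*-Solver
  lhs-⊕ (connect j i)   m m′ = trans
    (cong₂ ℤ._-_ (ℤ.pos-+ (x m (Fin.suc j) i) (x m′ (Fin.suc j) i))
                 (ℤ.pos-+ (y m (inject₁ j) i) (y m′ (inject₁ j) i)))
    (solve 4 (λ a b c d → (a :+ b) :- (c :+ d) := (a :- c) :+ (b :- d)) refl
       (ℤ.+ x m (Fin.suc j) i) (ℤ.+ x m′ (Fin.suc j) i) (ℤ.+ y m (inject₁ j) i) (ℤ.+ y m′ (inject₁ j) i))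
    where open ℤ-Solver.+-*-Solver
  lhs-⊕ (start i)       m m′ = ℤ.pos-+ (x m Fin.zero i) (x m′ Fin.zero i)
  lhs-⊕ (end i)         m m′ = ℤ.pos-+ (y m (fromℕ K) i) (y m′ (fromℕ K) i)

  lhs-tally-[] : ∀ r → lhs r (tally []) ≡ ℤ.+ 0
  lhs-tally-[] (kirchhoff j o) =
    Σℤ-zero (nT' ξ j) λ e → ℤ.*-zeroˡ (𝟏 (tgt (G (comp ξ j)) e) o ℤ.- 𝟏 (src (G (comp ξ j)) e) o)
  lhs-tally-[] (effect j i)    = cong (λ s → (ℤ.+ 0 ℤ.+ s) ℤ.- ℤ.+ 0)
    (Σℤ-zero (nT' ξ j) λ e → ℤ.*-zeroˡ (lab (G (comp ξ j)) e i))
  lhs-tally-[] (connect j i)   = refl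
  lhs-tally-[] (start i)       = refl
  lhs-tally-[] (end i)         = refl

  indicator-difference : ∀ b₁ b₂ →
    ℤ.∣ (if b₁ then ℤ.+ 1 else ℤ.+ 0) ℤ.- (if b₂ then ℤ.+ 1 else ℤ.+ 0) ∣ ≤ 1
  indicator-difference true  true  = z≤n
  indicator-difference true  false = s≤s z≤n
  indicator-difference false true  = s≤s z≤n
  indicator-difference false false = z≤n

  Σ-block≤norm1 : ∀ m j → Σ-block (value m) j ≤ norm1 m
  Σ-block≤norm1 m j = Σℕ-term (suc K) (Σ-block (value m)) j

  module _ {Λ : ℕ} (1≤Λ : 1 ≤ Λ)
           (labels-bounded : ∀ j e i → ℤ.∣ lab (G (comp ξ j)) e i ∣ ≤ Λ) where

    private
      n≤n*Λ : ∀ n → n ≤ n * Λ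
      n≤n*Λ n = ℕ.≤-trans (ℕ.≤-reflexive (sym (ℕ.*-identityʳ n))) (ℕ.*-monoʳ-≤ n 1≤Λ)

      ≤2Λ* : ∀ {v} (m : Assign ξ) → v ≤ 2 * norm1 m → v ≤ 2 * Λ * norm1 m
      ≤2Λ* m v≤ = ℕ.≤-trans v≤ (ℕ.*-monoˡ-≤ (norm1 m) (ℕ.*-monoʳ-≤ 2 1≤Λ))

      ≤2* : ∀ {v n} → v ≤ n → v ≤ 2 * n
      ≤2* {n = n} v≤n = ℕ.≤-trans v≤n (ℕ.m≤m+n n _)

    lhs-bound : ∀ r m → ℤ.∣ lhs r m ∣ ≤ 2 * Λ * norm1 m
    lhs-bound (kirchhoff j o) m = ≤2Λ* m (≤2* (ℕ.≤-trans
      (Σℤ-scaled-bound (nT' ξ j) (Ψ m j) _ λ e →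
         indicator-difference ⌊ tgt (G (comp ξ j)) e Fin.≟ o ⌋ ⌊ src (G (comp ξ j)) e Fin.≟ o ⌋)
      (ℕ.≤-trans (ℕ.≤-reflexive (ℕ.*-identityʳ P))
         (ℕ.≤-trans (ℕ.m≤n+m P (Σℕ D (x m j) + Σℕ D (y m j))) (Σ-block≤norm1 m j)))))
      where
      P : ℕ
      P = Σℕ (nT' ξ j) (Ψ m j)
    lhs-bound (effect j i) m = begin
      ℤ.∣ (xᵢ ℤ.+ Δ ξ m j i) ℤ.- yᵢ ∣      ≤⟨ ℤ.∣i-j∣≤∣i∣+∣j∣ (xᵢ ℤ.+ Δ ξ m j i) yᵢ ⟩
      ℤ.∣ xᵢ ℤ.+ Δ ξ m j i ∣ + y m j i     ≤⟨ ℕ.+-monoˡ-≤ (y m j i) (ℤ.∣i+j∣≤∣i∣+∣j∣ xᵢ (Δ ξ m j i)) ⟩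
      x m j i + ℤ.∣ Δ ξ m j i ∣ + y m j i  ≤⟨ ℕ.+-mono-≤ (ℕ.+-mono-≤ (Σℕ-term D (x m j) i)
                                               (Σℤ-scaled-bound (nT' ξ j) (Ψ m j) _ λ e → labels-bounded j e i))
                                               (Σℕ-term D (y m j) i) ⟩
      X + P * Λ + Y                        ≤⟨ ℕ.+-mono-≤ (ℕ.+-monoˡ-≤ (P * Λ) (n≤n*Λ X)) (n≤n*Λ Y) ⟩
      X * Λ + P * Λ + Y * Λ                ≡⟨ solve 4 (λ X Y P Λ → X :* Λ :+ P :* Λ :+ Y :* Λ := (X :+ Y :+ P) :* Λ)
                                               refl X Y P Λ ⟩
      Σ-block (value m) j * Λ              ≤⟨ ℕ.*-monoˡ-≤ Λ (Σ-block≤norm1 m j) ⟩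
      norm1 m * Λ                          ≡⟨ ℕ.*-comm (norm1 m) Λ ⟩
      Λ * norm1 m                          ≤⟨ ℕ.*-monoˡ-≤ (norm1 m) (ℕ.m≤m+n Λ (Λ + 0)) ⟩
      2 * Λ * norm1 m                      ∎
      where
      open ℕ.≤-Reasoning
      open ℕ-Solver.+-*-Solver
      xᵢ yᵢ : ℤ
      xᵢ = ℤ.+ x m j i
      yᵢ = ℤ.+ y m j i
      X Y P : ℕ
      X = Σℕ D (x m j)
      Y = Σℕ D (y m j)
      P = Σℕ (nT' ξ j) (Ψ m j)
    lhs-bound (connect j i) m = ≤2Λ* m (ℕ.≤-trans
      (ℤ.∣i-j∣≤∣i∣+∣j∣ (ℤ.+ x m (Fin.suc j) i) (ℤ.+ y m (inject₁ j) i)) (ℕ.≤-trans (ℕ.+-mono-≤ (value≤norm1 m (xVar (Fin.suc j) i)) (value≤norm1 m (yVar (inject₁ j) i)))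
                 (ℕ.≤-reflexive (cong (norm1 m +_) (sym (ℕ.+-identityʳ (norm1 m)))))))
    lhs-bound (start i) m = ≤2Λ* m (≤2* (value≤norm1 m (xVar Fin.zero i)))
    lhs-bound (end i)   m = ≤2Λ* m (≤2* (value≤norm1 m (yVar (fromℕ K) i)))

  module _ {a b : Fin D → ℕ} {m : Assign ξ} where

    private
      connect-lhs : ∀ j i → lhs (connect j i) m ≡ conn ξ j i →
        ℤ.+ y m (inject₁ j) i ℤ.+ conn ξ j i ≡ ℤ.+ x m (Fin.suc j) i
      connect-lhs j i e = trans (cong (λ c → ℤ.+ y m (inject₁ j) i ℤ.+ c) (sym e))
        (solve 2 (λ u v → v :+ (u :- v) := u) refl (ℤ.+ x m (Fin.suc j) i) (ℤ.+ y m (inject₁ j) i))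
        where open ℤ-Solver.+-*-Solver

    solution⇒lhs≡rhs : Sol a ξ b m → ∀ r → lhs r m ≡ rhs a b r
    solution⇒lhs≡rhs s (kirchhoff j o) = Sol.kirchhoff s j o
    solution⇒lhs≡rhs s (effect j i)    = ℤ.i≡j⇒i-j≡0 (Sol.effect s j i)
    solution⇒lhs≡rhs s (connect j i)   = trans (cong (ℤ._- ℤ.+ y m (inject₁ j) i) (sym (Sol.connect s j i)))
      (solve 2 (λ u c → (u :+ c) :- u := c) refl (ℤ.+ y m (inject₁ j) i) (conn ξ j i))
      where open ℤ-Solver.+-*-Solver
    solution⇒lhs≡rhs s (start i)       = cong ℤ.+_ (Sol.start s i)
    solution⇒lhs≡rhs s (end i)         = cong ℤ.+_ (Sol.end s i)

    lhs≡rhs⇒solution : (∀ r → lhs r m ≡ rhs a b r) → (∀ j e → 0 < Ψ m j e) → Sol a ξ b m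
    lhs≡rhs⇒solution l≡r positive = record
      { kirchhoff = λ j o → l≡r (kirchhoff j o)
      ; positive  = positive
      ; effect    = λ j i → ℤ.i-j≡0⇒i≡j _ _ (l≡r (effect j i))
      ; connect   = λ j i → connect-lhs j i (l≡r (connect j i))
      ; start     = λ i → ℤ.+-injective (l≡r (start i))
      ; end       = λ i → ℤ.+-injective (l≡r (end i))
      }

    homogeneous⇒lhs≡0 : Sol0 a ξ b m → ∀ r → lhs r m ≡ ℤ.+ 0
    homogeneous⇒lhs≡0 s (kirchhoff j o) = Sol0.kirchhoff s j o
    homogeneous⇒lhs≡0 s (effect j i)    = ℤ.i≡j⇒i-j≡0 (Sol0.effect s j i)
    homogeneous⇒lhs≡0 s (connect j i)   = ℤ.i≡j⇒i-j≡0 (cong ℤ.+_ (sym (Sol0.connect s j i)))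
    homogeneous⇒lhs≡0 s (start i)       = cong ℤ.+_ (Sol0.start s i)
    homogeneous⇒lhs≡0 s (end i)         = cong ℤ.+_ (Sol0.end s i)

    lhs≡0⇒homogeneous : (∀ r → lhs r m ≡ ℤ.+ 0) → 0 < norm1 m → Sol0 a ξ b m
    lhs≡0⇒homogeneous l≡0 nontrivial = record
      { kirchhoff  = λ j o → l≡0 (kirchhoff j o)
      ; effect     = λ j i → ℤ.i-j≡0⇒i≡j _ _ (l≡0 (effect j i))
      ; connect    = λ j i → ℤ.+-injective (sym (ℤ.i-j≡0⇒i≡j _ _ (l≡0 (connect j i))))
      ; start      = λ i → ℤ.+-injective (l≡0 (start i))
      ; end        = λ i → ℤ.+-injective (l≡0 (end i))
      ; nontrivial = nontrivial
      }

  each : ∀ n → (Fin n → Row) → List Row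
  each n f = concatF n λ i → [ f i ]

  ∈-each : ∀ n f i → f i ∈ each n f
  ∈-each n f i = ∈-concatF n (λ i → [ f i ]) i (here refl)

  kirchhoff-rows effect-rows connect-rows boundary-rows : List Row
  kirchhoff-rows = concatF (suc K) λ j → each (nQ (G (comp ξ j))) (kirchhoff j)
  effect-rows    = concatF (suc K) λ j → each D (effect j)
  connect-rows   = concatF K λ j → each D (connect j)
  boundary-rows  = each D start ++ each D end

  rows : List Row
  rows = kirchhoff-rows ++ effect-rows ++ connect-rows ++ boundary-rows

  rows-complete : ∀ r → r ∈ rows
  rows-complete (kirchhoff j o) = ∈.∈-++⁺ˡ
    (∈-concatF (suc K) (λ j → each (nQ (G (comp ξ j))) (kirchhoff j)) j (∈-each _ (kirchhoff j) o))
  rows-complete (effect j i)    = ∈.∈-++⁺ʳ kirchhoff-rows (∈.∈-++⁺ˡ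
    (∈-concatF (suc K) (λ j → each D (effect j)) j (∈-each D (effect j) i)))
  rows-complete (connect j i)   = ∈.∈-++⁺ʳ kirchhoff-rows (∈.∈-++⁺ʳ effect-rows (∈.∈-++⁺ˡ
    (∈-concatF K (λ j → each D (connect j)) j (∈-each D (connect j) i))))
  rows-complete (start i)       = ∈.∈-++⁺ʳ kirchhoff-rows (∈.∈-++⁺ʳ effect-rows
    (∈.∈-++⁺ʳ connect-rows (∈.∈-++⁺ˡ (∈-each D start i))))
  rows-complete (end i)         = ∈.∈-++⁺ʳ kirchhoff-rows (∈.∈-++⁺ʳ effect-rows
    (∈.∈-++⁺ʳ connect-rows (∈.∈-++⁺ʳ (each D start) (∈-each D end i))))

  length-each : ∀ n f → length (each n f) ≡ n
  length-each n f = trans (additive-concatF length length-additive n (λ i → [ f i ]))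
                          (trans (Σℕ-const n 1) (ℕ.*-identityʳ n))

  length-grid : ∀ n {c} (g : Fin n → Fin c → Row) → length (concatF n λ j → each c (g j)) ≡ n * c
  length-grid n {c} g = trans (additive-concatF length length-additive n (λ j → each c (g j)))
                              (trans (Σℕ-cong n λ j → length-each c (g j)) (Σℕ-const n c))

  length-rows : length rows ≡ Σℕ (suc K) (λ j → nQ (G (comp ξ j))) + (suc K * D + (K * D + (D + D)))
  length-rows = trans (List.length-++ kirchhoff-rows)
    (cong₂ _+_ length-kirchhoff (trans (List.length-++ effect-rows)
      (cong₂ _+_ (length-grid (suc K) effect) (trans (List.length-++ connect-rows)
        (cong₂ _+_ (length-grid K connect) (trans (List.length-++ (each D start))
          (cong₂ _+_ (length-each D start) (length-each D end))))))))
    where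
    length-kirchhoff : length kirchhoff-rows ≡ Σℕ (suc K) (λ j → nQ (G (comp ξ j)))
    length-kirchhoff = trans
      (additive-concatF length length-additive (suc K) λ j → each (nQ (G (comp ξ j))) (kirchhoff j))
                      (Σℕ-cong (suc K) λ j → length-each (nQ (G (comp ξ j))) (kirchhoff j))

module MinimalSolutions {D : ℕ} (ξ : CGS D) {Λ : ℕ} (1≤Λ : 1 ℕ.≤ Λ)
  (labels-bounded : ∀ j e i → ℤ.∣ lab (G (comp ξ j)) e i ∣ ℕ.≤ Λ) where
  open import Defs

  open import Data.Nat as ℕ using (z≤n; _+_; _*_; _≤_; _<_; _∸_)
  import Data.Nat.Properties as ℕ
  import Data.Integer.Properties as ℤ
  open import Data.List using (List; []; _∷_; _++_; [_]; length)
  open import Data.List.Relation.Unary.All as All using (All)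
  open import Data.List.Relation.Binary.Permutation.Propositional using (_↭_)
  open import Data.Product using (∃; _,_)
  open import Data.Empty using (⊥; ⊥-elim)
  open import Data.Fin using (Fin)
  open import Relation.Nullary using (yes; no)
  open import Relation.Binary.PropositionalEquality hiding ([_])

  open CharacteristicSystem ξ
  import Data.Integer.Solver as ℤ-Solver
  import Data.Nat.Solver as ℕ-Solver

  column : Var → Row → ℤ
  column t r = lhs r (tally [ t ])

  open PrefixSumCollision rows column using (total; ZeroSplit; collision; collision-bound)

  total≡lhs : ∀ S r → total S r ≡ lhs r (tally S)
  total≡lhs []      r = sym (lhs-tally-[] r)
  total≡lhs (t ∷ S) r = trans (cong (λ z → column t r ℤ.+ z) (total≡lhs S r))
    (sym (trans (lhs-cong r (tally-++ [ t ] S)) (lhs-⊕ r (tally [ t ]) (tally S))))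

  column-bound : ∀ t r → ℤ.∣ column t r ∣ ≤ 2 * Λ
  column-bound t r = ℕ.≤-trans (lhs-bound 1≤Λ labels-bounded r (tally [ t ]))
    (ℕ.≤-reflexive (trans (cong (2 * Λ *_) (norm1-tally-singleton t)) (ℕ.*-identityʳ (2 * Λ))))

  lhs-≈⊕ : ∀ {m m₁ m₂ : Assign ξ} r → m ≈ m₁ ⊕ m₂ → lhs r m ≡ lhs r m₁ ℤ.+ lhs r m₂
  lhs-≈⊕ {m₁ = m₁} {m₂} r m≈ = trans (lhs-cong r m≈) (lhs-⊕ r m₁ m₂)

  below-minimal : ∀ {P : Assign ξ → Set} {m} m₁ m₂ → Minimal P m → m ≈ m₁ ⊕ m₂ → P m₁ →
    (∃ λ t → 0 < value m₂ t) → ⊥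
  below-minimal {m = m} m₁ m₂ (_ , minimal) m≈ P-m₁ (t , 0<m₂) =
    ℕ.<-irrefl refl
      (ℕ.≤-<-trans m≤m₁ (subst (value m₁ t <_) (sym (decomposed t)) (ℕ.m<m+n (value m₁ t) 0<m₂)))
    where
    decomposed : ∀ u → value m u ≡ value m₁ u + value m₂ u
    decomposed u = trans (m≈ u) (value-⊕ m₁ m₂ u)
    m≤m₁ : value m t ≤ value m₁ t
    m≤m₁ = ≼-to-≤ (minimal m₁ P-m₁ (≼-from-≤ λ u →
      subst (value m₁ u ≤_) (sym (decomposed u)) (ℕ.m≤m+n (value m₁ u) (value m₂ u)))) t

  nonempty-tally : ∀ {S} → S ≢ [] → ∃ λ t → 0 < value (tally S) t
  nonempty-tally {[]}    S≢[] = ⊥-elim (S≢[] refl)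
  nonempty-tally {t ∷ S} _    = t , tally-∷-positive t S

  tokens-split : ∀ m S Rest → tokens m ↭ S ++ Rest → m ≈ tally S ⊕ tally Rest
  tokens-split m S Rest split t =
    trans (sym (tally-tokens m t)) (trans (tally-↭ split t) (tally-++ S Rest t))

  tokens-short : ∀ u (c : Row → ℤ) B → 2 * Λ ≤ B → (∀ r → ℤ.∣ c r ∣ ≤ B) →
    (∀ r → lhs r u ≡ c r) → (ZeroSplit (tokens u) → ⊥) → norm1 u ≤ collision-bound B
  tokens-short u c B 2Λ≤B c-bounded lhs≡c no-split with length (tokens u) ℕ.≤? collision-bound B
  ... | yes short = subst (_≤ collision-bound B) (length-tokens u) short
  ... | no  long  = ⊥-elim (no-split (collision (tokens u) c B
    (All.tabulate λ {t} _ → All.tabulate λ {r} _ → ℕ.≤-trans (column-bound t r) 2Λ≤B)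
    (All.tabulate λ {r} _ → c-bounded r)
    (All.tabulate λ {r} _ → trans (total≡lhs (tokens u) r) (trans (lhs-cong r (tally-tokens u)) (lhs≡c r)))
    (ℕ.≰⇒> long)))

  zero-part-lhs : ∀ {L} (Z : ZeroSplit L) r → lhs r (tally (ZeroSplit.zero-part Z)) ≡ ℤ.+ 0
  zero-part-lhs Z r = trans (sym (total≡lhs zero-part r)) (All.lookup zero-total (rows-complete r))
    where open ZeroSplit Z

  zero-part-homogeneous : ∀ {a b L} (Z : ZeroSplit L) → Sol0 a ξ b (tally (ZeroSplit.zero-part Z))
  zero-part-homogeneous Z = lhs≡0⇒homogeneous (zero-part-lhs Z)
    (let t , 0<t = nonempty-tally zero-part-nonempty in ℕ.<-≤-trans 0<t (value≤norm1 (tally zero-part) t))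
    where open ZeroSplit Z

  homogeneous-bound : ∀ {a b m} B → 2 * Λ ≤ B → Minimal (Sol0 a ξ b) m → norm1 m ≤ collision-bound B
  homogeneous-bound {m = m} B 2Λ≤B minimal@(solution , _) =
    tokens-short m (λ _ → ℤ.+ 0) B 2Λ≤B (λ _ → z≤n) (homogeneous⇒lhs≡0 solution) λ Z →
      let open ZeroSplit Z in
      below-minimal (tally zero-part) (tally rest) minimal (tokens-split m zero-part rest split)
        (zero-part-homogeneous Z) (nonempty-tally rest-nonempty)

  base : Assign ξ
  base = record { x = λ _ _ → 0 ; y = λ _ _ → 0 ; Ψ = λ _ _ → 1 }

  shift : Assign ξ → Assign ξ
  shift m = record { x = x m ; y = y m ; Ψ = λ j e → Ψ m j e ∸ 1 }

  shift-⊕-base : ∀ {m} → (∀ j e → 0 < Ψ m j e) → m ≈ shift m ⊕ base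
  shift-⊕-base {m} positive t = trans (value-shift t) (sym (value-⊕ (shift m) base t))
    where
    value-shift : ∀ t → value m t ≡ value (shift m) t + value base t
    value-shift (xVar j i) = sym (ℕ.+-identityʳ (x m j i))
    value-shift (yVar j i) = sym (ℕ.+-identityʳ (y m j i))
    value-shift (ψVar j e) = sym (ℕ.m∸n+n≡m (positive j e))

  regroup : ∀ {m u c v w : Assign ξ} → m ≈ u ⊕ c → u ≈ v ⊕ w → m ≈ (w ⊕ c) ⊕ v
  regroup {m} {u} {c} {v} {w} m≈ u≈ t = begin
    value m t                         ≡⟨ trans (m≈ t) (value-⊕ u c t) ⟩
    value u t + value c t             ≡⟨ cong (_+ value c t) (trans (u≈ t) (value-⊕ v w t)) ⟩
    value v t + value w t + value c t ≡⟨ solve 3 (λ v w c → v :+ w :+ c := w :+ c :+ v) refl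
                                           (value v t) (value w t) (value c t) ⟩
    value w t + value c t + value v t ≡⟨ sym (trans (value-⊕ (w ⊕ c) v t)
                                                     (cong (_+ value v t) (value-⊕ w c t))) ⟩
    value ((w ⊕ c) ⊕ v) t             ∎
    where
    open ≡-Reasoning
    open ℕ-Solver.+-*-Solver

  -- The positivity constraints are kept aside in base; the rest is handled as in the homogeneous case.
  module _ {a b : Fin D → ℕ} {m : Assign ξ} (solution : Sol a ξ b m) where

    private
      m≈ : m ≈ shift m ⊕ base
      m≈ = shift-⊕-base (Sol.positive solution)

    lhs-shift+base : ∀ r → lhs r (shift m) ℤ.+ lhs r base ≡ rhs a b r
    lhs-shift+base r = trans (sym (lhs-≈⊕ r m≈)) (solution⇒lhs≡rhs solution r)

    lhs-shift : ∀ r → lhs r (shift m) ≡ rhs a b r ℤ.- lhs r base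
    lhs-shift r = trans (solve 2 (λ u v → u := (u :+ v) :- v) refl (lhs r (shift m)) (lhs r base))
                        (cong (ℤ._- lhs r base) (lhs-shift+base r))
      where open ℤ-Solver.+-*-Solver

    norm1-shift : norm1 m ≡ norm1 (shift m) + norm1 base
    norm1-shift = trans (norm1-cong {m} {shift m ⊕ base} m≈) (norm1-⊕ (shift m) base)

    module _ (Z : ZeroSplit (tokens (shift m))) where
      open ZeroSplit Z

      private
        shift≈ : shift m ≈ tally zero-part ⊕ tally rest
        shift≈ = tokens-split (shift m) zero-part rest split

      split-solution : m ≈ (tally rest ⊕ base) ⊕ tally zero-part
      split-solution = regroup {v = tally zero-part} {w = tally rest} m≈ shift≈

      rest-solves : Sol a ξ b (tally rest ⊕ base)
      rest-solves = lhs≡rhs⇒solution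
        (λ r → trans (lhs-⊕ r (tally rest) base) (trans (cong (ℤ._+ lhs r base) (lhs-rest r)) (lhs-shift+base r)))
        (λ j e → ℕ.m≤n+m 1 (value (tally rest) (ψVar j e)))
        where
        lhs-rest : ∀ r → lhs r (tally rest) ≡ lhs r (shift m)
        lhs-rest r = sym (trans (lhs-≈⊕ r shift≈)
          (trans (cong (ℤ._+ lhs r (tally rest)) (zero-part-lhs Z r)) (ℤ.+-identityˡ (lhs r (tally rest)))))

  inhomogeneous-bound : ∀ {a b m} B → 2 * Λ ≤ B → (∀ r → ℤ.∣ rhs a b r ℤ.- lhs r base ∣ ≤ B) →
    Minimal (Sol a ξ b) m → norm1 m ≤ collision-bound B + norm1 base
  inhomogeneous-bound {a} {b} {m} B 2Λ≤B bounded minimal@(solution , _) =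
    subst (_≤ collision-bound B + norm1 base) (sym (norm1-shift solution))
      (ℕ.+-monoˡ-≤ (norm1 base)
        (tokens-short (shift m) (λ r → rhs a b r ℤ.- lhs r base) B 2Λ≤B bounded (lhs-shift solution) λ Z →
          let open ZeroSplit Z in
          below-minimal (tally rest ⊕ base) (tally zero-part) minimal (split-solution solution Z)
            (rest-solves solution Z) (nonempty-tally zero-part-nonempty)))

module EncodingSize where
  open import Defs
  open import Data.Nat as ℕ using (ℕ; zero; suc; z≤n; s≤s; _+_; _*_; _≤_; _<_; _^_)
  import Data.Nat.Properties as ℕ
  open import Data.Nat.Logarithm using (⌊log₂_⌋; ⌊log₂⌋-mono-≤; ⌊log₂[2^n]⌋≡n)
  open import Data.Integer as ℤ using (ℤ)
  open import Data.Fin using (Fin; zero; suc)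
  open import Data.Product using (_×_; _,_)
  open import Data.Sum using (_⊎_; inj₁; inj₂)
  open import Function using (_∘_)
  open import Relation.Binary.PropositionalEquality

  open FiniteSums

  n<2^[1+⌊log₂n⌋] : ∀ n → n < 2 ^ suc ⌊log₂ n ⌋
  n<2^[1+⌊log₂n⌋] n = ℕ.≰⇒> λ 2^[1+L]≤n → ℕ.<-irrefl refl (ℕ.≤-trans
    (ℕ.≤-reflexive (sym (⌊log₂[2^n]⌋≡n (suc ⌊log₂ n ⌋)))) (⌊log₂⌋-mono-≤ 2^[1+L]≤n))

  ∣∣≤2^bits : ∀ z → ℤ.∣ z ∣ ≤ 2 ^ bitsℤ z
  ∣∣≤2^bits z =
    ℕ.≤-trans (ℕ.<⇒≤ (n<2^[1+⌊log₂n⌋] ℤ.∣ z ∣)) (ℕ.^-monoʳ-≤ 2 (ℕ.n≤1+n (suc ⌊log₂ ℤ.∣ z ∣ ⌋)))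

  n≤2^n : ∀ n → n ≤ 2 ^ n
  n≤2^n zero    = z≤n
  n≤2^n (suc n) = ℕ.+-mono-≤ (ℕ.m^n>0 2 n) (ℕ.≤-trans (n≤2^n n) (ℕ.m≤m+n (2 ^ n) 0))

  ∣∣≤2^sizeVec : ∀ {D} (v : Fin D → ℤ) i → ℤ.∣ v i ∣ ≤ 2 ^ sizeVec v
  ∣∣≤2^sizeVec {D} v i = ℕ.≤-trans (∣∣≤2^bits (v i)) (ℕ.^-monoʳ-≤ 2 (Σℕ-term D (bitsℤ ∘ v) i))

  D≤sizeVec : ∀ {D} (v : Fin D → ℤ) → D ≤ sizeVec v
  D≤sizeVec {D} v = ℕ.≤-trans (ℕ.≤-reflexive (sym (trans (Σℕ-const D 1) (ℕ.*-identityʳ D))))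
    (Σℕ-mono D λ i → s≤s z≤n)

  module _ {D : ℕ} (a : Fin D → ℕ) (ξ : CGS D) (b : Fin D → ℕ) where

    private
      s K : ℕ
      s = size a ξ b
      K = k ξ
      graph : Fin (suc K) → VASS D
      graph j = G (comp ξ j)
      labels : VASS D → ℕ
      labels H = Σℕ (nT H) λ e → 1 + sizeVec (lab H e)
      connections : ℕ
      connections = Σℕ K λ j → 1 + sizeVec (conn ξ j)

      cgs≤s : sizeCGS ξ ≤ s
      cgs≤s = ℕ.≤-trans (ℕ.m≤n+m (sizeCGS ξ) (Σℕ D a)) (ℕ.m≤m+n _ (Σℕ D b))

      graphs≤s : Σℕ (suc K) (sizeVASS ∘ graph) ≤ s
      graphs≤s = ℕ.≤-trans (ℕ.m≤m+n _ connections) cgs≤s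

      graph≤s : ∀ j → sizeVASS (graph j) ≤ s
      graph≤s j = ℕ.≤-trans (Σℕ-term (suc K) (λ j → sizeVASS (graph j)) j) graphs≤s

      label≤s : ∀ j e → 1 + sizeVec (lab (graph j) e) ≤ s
      label≤s j e = ℕ.≤-trans (Σℕ-term (nT (graph j)) (λ e → 1 + sizeVec (lab (graph j) e)) e)
                      (ℕ.≤-trans (ℕ.m≤n+m (labels (graph j)) (nQ (graph j))) (graph≤s j))

      connection≤s : ∀ j → 1 + sizeVec (conn ξ j) ≤ s
      connection≤s j = ℕ.≤-trans (Σℕ-term K (λ j → 1 + sizeVec (conn ξ j)) j)
                         (ℕ.≤-trans (ℕ.m≤n+m connections _) cgs≤s)

    entries-a≤size : ∀ i → a i ≤ s
    entries-a≤size i =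
      ℕ.≤-trans (Σℕ-term D a i) (ℕ.≤-trans (ℕ.m≤m+n _ (sizeCGS ξ)) (ℕ.m≤m+n _ (Σℕ D b)))

    entries-b≤size : ∀ i → b i ≤ s
    entries-b≤size i = ℕ.≤-trans (Σℕ-term D b i) (ℕ.m≤n+m _ _)

    Σa+Σb≤size : Σℕ D a + Σℕ D b ≤ s
    Σa+Σb≤size = ℕ.+-monoˡ-≤ (Σℕ D b) (ℕ.m≤m+n (Σℕ D a) (sizeCGS ξ))

    labels≤2^size : ∀ j e i → ℤ.∣ lab (graph j) e i ∣ ≤ 2 ^ s
    labels≤2^size j e i = ℕ.≤-trans (∣∣≤2^sizeVec (lab (graph j) e) i)
      (ℕ.^-monoʳ-≤ 2 (ℕ.≤-trans (ℕ.n≤1+n _) (label≤s j e)))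

    connections≤2^size : ∀ j i → ℤ.∣ conn ξ j i ∣ ≤ 2 ^ s
    connections≤2^size j i = ℕ.≤-trans (∣∣≤2^sizeVec (conn ξ j) i)
      (ℕ.^-monoʳ-≤ 2 (ℕ.≤-trans (ℕ.n≤1+n _) (connection≤s j)))

    states≤size : Σℕ (suc K) (λ j → nQ (graph j)) ≤ s
    states≤size = ℕ.≤-trans (Σℕ-mono (suc K) λ j → ℕ.m≤m+n (nQ (graph j)) (labels (graph j))) graphs≤s

    edges≤size : Σℕ (suc K) (λ j → nT (graph j)) ≤ s
    edges≤size = ℕ.≤-trans
      (Σℕ-mono (suc K) λ j → ℕ.≤-trans (edges≤labels (graph j)) (ℕ.m≤n+m _ (nQ (graph j)))) graphs≤s
      where
      edges≤labels : ∀ H → nT H ≤ labels H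
      edges≤labels H = ℕ.≤-trans (ℕ.≤-reflexive (sym (trans (Σℕ-const (nT H) 1) (ℕ.*-identityʳ (nT H)))))
                         (Σℕ-mono (nT H) λ e → s≤s z≤n)

    components≤size : suc K ≤ s
    components≤size = ℕ.≤-trans (ℕ.≤-reflexive (sym (trans (Σℕ-const (suc K) 1) (ℕ.*-identityʳ (suc K)))))
      (ℕ.≤-trans (Σℕ-mono (suc K) λ j → nonempty (p (comp ξ j))) states≤size)
      where
      nonempty : ∀ {n} → Fin n → 1 ≤ n
      nonempty {suc n} _ = s≤s z≤n

    -- Without any edge or connection the dimension D need not be bounded by the size.
    dimension≤size : D ≤ s ⊎ (K ≡ 0 × nT (graph zero) ≡ 0)
    dimension≤size = by-components K refl
      where
      by-edges : ∀ n → nT (graph zero) ≡ n → K ≡ 0 → D ≤ s ⊎ (K ≡ 0 × nT (graph zero) ≡ 0)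
      by-edges zero    nT≡0 K≡0 = inj₂ (K≡0 , nT≡0)
      by-edges (suc _) nT≡  _   =
        inj₁ (ℕ.≤-trans (D≤sizeVec (lab (graph zero) e)) (ℕ.≤-trans (ℕ.n≤1+n _) (label≤s zero e)))
        where e = subst Fin (sym nT≡) zero
      by-components : ∀ n → K ≡ n → D ≤ s ⊎ (K ≡ 0 × nT (graph zero) ≡ 0)
      by-components zero    K≡0 = by-edges (nT (graph zero)) refl K≡0
      by-components (suc _) K≡  =
        inj₁ (ℕ.≤-trans (D≤sizeVec (conn ξ j)) (ℕ.≤-trans (ℕ.n≤1+n _) (connection≤s j)))
        where j = subst Fin (sym K≡) zero

open import Defs
open import Data.Nat as ℕ using (ℕ; suc; z≤n; _+_; _*_; _≤_; _^_)
import Data.Nat.Properties as ℕ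
import Data.Nat.Solver as ℕ-Solver
open import Data.Integer as ℤ using (ℤ)
import Data.Integer.Properties as ℤ
open import Data.Fin as Fin using (Fin)
open import Data.List using (List; []; _∷_; length)
open import Data.Product using (Σ; _,_)
open import Data.Sum using (_⊎_; inj₁; inj₂)
open import Relation.Nullary.Decidable using (⌊_⌋)
open import Data.Empty using (⊥; ⊥-elim)
open import Relation.Binary.PropositionalEquality

open FiniteSums
open EncodingSize

2^n+2^n≡2^[1+n] : ∀ n → 2 ^ n + 2 ^ n ≡ 2 ^ suc n
2^n+2^n≡2^[1+n] n = cong (2 ^ n +_) (sym (ℕ.+-identityʳ (2 ^ n)))

-- Powers of 2 absorb the factors: (2 (2 d B + B) + 1)^d ≤ ((4 d + 3) B)^d ≤ 2^((4 d + 3 + e) d).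
collision-bound-exponential : ∀ d B e → 1 ≤ B → B ≤ 2 ^ e →
  suc (2 * (d * (2 * B) + B)) ^ d ≤ 2 ^ ((4 * d + 3 + e) * d)
collision-bound-exponential d B e 1≤B B≤2^e = begin
  suc (2 * (d * (2 * B) + B)) ^ d        ≤⟨ ℕ.^-monoˡ-≤ d base≤ ⟩
  ((4 * d + 3) * B) ^ d                  ≤⟨ ℕ.^-monoˡ-≤ d (ℕ.*-mono-≤ (n≤2^n (4 * d + 3)) B≤2^e) ⟩
  (2 ^ (4 * d + 3) * 2 ^ e) ^ d          ≡⟨ cong (_^ d) (sym (ℕ.^-distribˡ-+-* 2 (4 * d + 3) e)) ⟩
  (2 ^ (4 * d + 3 + e)) ^ d              ≡⟨ ℕ.^-*-assoc 2 (4 * d + 3 + e) d ⟩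
  2 ^ ((4 * d + 3 + e) * d)              ∎
  where
  open ℕ.≤-Reasoning
  base≤ : suc (2 * (d * (2 * B) + B)) ≤ (4 * d + 3) * B
  base≤ = ℕ.≤-trans (ℕ.+-monoˡ-≤ (2 * (d * (2 * B) + B)) 1≤B)
    (ℕ.≤-reflexive (solve 2 (λ d B → B :+ con 2 :* (d :* (con 2 :* B) :+ B) := (con 4 :* d :+ con 3) :* B)
                              refl d B))
    where open ℕ-Solver.+-*-Solver

rows-polynomial : ℕ → ℕ
rows-polynomial s = s + (s * s + (s * s + (s + s)))

collision-exponent : ℕ → ℕ
collision-exponent s = (4 * rows-polynomial s + 3 + (suc s + suc s)) * rows-polynomial s

exponent : ℕ → ℕ
exponent s = collision-exponent s + s

only-zero : ∀ {n} → n ≡ 0 → (j : Fin (suc n)) → j ≡ Fin.zero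
only-zero refl Fin.zero = refl

module _ {D : ℕ} (a : Fin D → ℕ) (ξ : CGS D) (b : Fin D → ℕ) where

  open CharacteristicSystem ξ

  private
    s Λ Δ⋆ : ℕ
    s = size a ξ b
    Λ = 2 ^ s
    -- Bounds the columns (by 2 Λ) as well as the right-hand sides (by Λ + 2 Λ s).
    Δ⋆ = 2 * Λ * suc s

  open MinimalSolutions ξ (ℕ.m^n>0 2 s) (labels≤2^size a ξ b)
  open PrefixSumCollision rows column using (collision-bound)

  rhs-bound : ∀ r → ℤ.∣ rhs a b r ∣ ≤ Λ
  rhs-bound (kirchhoff j o) =
    ℕ.≤-trans (indicator-difference ⌊ q (comp ξ j) Fin.≟ o ⌋ ⌊ p (comp ξ j) Fin.≟ o ⌋) (ℕ.m^n>0 2 s)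
  rhs-bound (effect j i)    = z≤n
  rhs-bound (connect j i)   = connections≤2^size a ξ b j i
  rhs-bound (start i)       = ℕ.≤-trans (entries-a≤size a ξ b i) (n≤2^n s)
  rhs-bound (end i)         = ℕ.≤-trans (entries-b≤size a ξ b i) (n≤2^n s)

  norm1-base : norm1 base ≤ s
  norm1-base = subst (_≤ s) (sym (Σℕ-cong (suc K) λ j →
      trans (cong₂ (λ u v → u + v + Σℕ (nT' ξ j) (λ _ → 1)) (Σℕ-zero D λ _ → refl)
                                                                 (Σℕ-zero D λ _ → refl))
            (trans (Σℕ-const (nT' ξ j) 1) (ℕ.*-identityʳ (nT' ξ j)))))
    (edges≤size a ξ b)

  rhs-base-bound : ∀ r → ℤ.∣ rhs a b r ℤ.- lhs r base ∣ ≤ Δ⋆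
  rhs-base-bound r = begin
    ℤ.∣ rhs a b r ℤ.- lhs r base ∣      ≤⟨ ℤ.∣i-j∣≤∣i∣+∣j∣ (rhs a b r) (lhs r base) ⟩
    ℤ.∣ rhs a b r ∣ + ℤ.∣ lhs r base ∣  ≤⟨ ℕ.+-mono-≤ (ℕ.≤-trans (rhs-bound r) (ℕ.m≤m+n Λ (Λ + 0)))
                                             (lhs-bound (ℕ.m^n>0 2 s) (labels≤2^size a ξ b) r base) ⟩
    2 * Λ + 2 * Λ * norm1 base          ≤⟨ ℕ.+-monoʳ-≤ (2 * Λ) (ℕ.*-monoʳ-≤ (2 * Λ) norm1-base) ⟩
    2 * Λ + 2 * Λ * s                   ≡⟨ sym (ℕ.*-suc (2 * Λ) s) ⟩
    Δ⋆                                  ∎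
    where open ℕ.≤-Reasoning

  2Λ≤Δ⋆ : 2 * Λ ≤ Δ⋆
  2Λ≤Δ⋆ = ℕ.m≤m*n (2 * Λ) (suc s)

  Δ⋆≤2^[2+2s] : Δ⋆ ≤ 2 ^ (suc s + suc s)
  Δ⋆≤2^[2+2s] = ℕ.≤-trans (ℕ.*-monoʳ-≤ (2 ^ suc s) (n≤2^n (suc s)))
                         (ℕ.≤-reflexive (sym (ℕ.^-distribˡ-+-* 2 (suc s) (suc s))))

  rows≤polynomial : D ≤ s → length rows ≤ rows-polynomial s
  rows≤polynomial D≤s = ℕ.≤-trans (ℕ.≤-reflexive length-rows)
    (ℕ.+-mono-≤ (states≤size a ξ b) (ℕ.+-mono-≤ (ℕ.*-mono-≤ (components≤size a ξ b) D≤s)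
      (ℕ.+-mono-≤ (ℕ.*-mono-≤ (ℕ.≤-trans (ℕ.n≤1+n K) (components≤size a ξ b)) D≤s)
                  (ℕ.+-mono-≤ D≤s D≤s))))

  size≤2^exponent : s ≤ 2 ^ exponent s
  size≤2^exponent = ℕ.≤-trans (n≤2^n s) (ℕ.^-monoʳ-≤ 2 (ℕ.m≤n+m s (collision-exponent s)))

  collision-bound≤2^exponent : D ≤ s → collision-bound Δ⋆ ≤ 2 ^ exponent s
  collision-bound≤2^exponent D≤s = ℕ.≤-trans
    (collision-bound-exponential (length rows) Δ⋆ (suc s + suc s)
      (ℕ.≤-trans (ℕ.m^n>0 2 (suc s)) 2Λ≤Δ⋆) Δ⋆≤2^[2+2s])
    (ℕ.^-monoʳ-≤ 2 (ℕ.≤-trans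
      (ℕ.*-mono-≤ (ℕ.+-monoˡ-≤ (suc s + suc s) (ℕ.+-monoˡ-≤ 3 (ℕ.*-monoʳ-≤ 4 rows≤))) rows≤)
      (ℕ.m≤m+n (collision-exponent s) s)))
    where
    rows≤ : length rows ≤ rows-polynomial s
    rows≤ = rows≤polynomial D≤s

  -- With a single component and no edges, x₀ = a and y₀ = b are the only variables.
  degenerate-bound : ∀ {m} → K ≡ 0 → nT' ξ Fin.zero ≡ 0 →
    Minimal (Sol a ξ b) m ⊎ Minimal (Sol0 a ξ b) m → norm1 m ≤ s
  degenerate-bound {m} K≡0 nT≡0 minimal = subst (_≤ s) (sym norm1≡) (endpoints minimal)
    where
    no-edge : Fin 0 → ⊥
    no-edge ()
    norm1≡ : norm1 m ≡ Σℕ D (x m Fin.zero) + Σℕ D (y m Fin.zero)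
    norm1≡ = trans
      (Σℕ-single (suc K) {Σ-block (value m)} Fin.zero λ j j≢0 → ⊥-elim (j≢0 (only-zero K≡0 j)))
      (trans (cong (Σℕ D (x m Fin.zero) + Σℕ D (y m Fin.zero) +_)
                   (Σℕ-zero (nT' ξ Fin.zero) {Ψ m Fin.zero} λ e → ⊥-elim (no-edge (subst Fin nT≡0 e))))
             (ℕ.+-identityʳ _))
    y-end : ∀ i → y m Fin.zero i ≡ y m (Fin.fromℕ K) i
    y-end i = cong (λ j → y m j i) (sym (only-zero K≡0 (Fin.fromℕ K)))
    endpoints : Minimal (Sol a ξ b) m ⊎ Minimal (Sol0 a ξ b) m →
      Σℕ D (x m Fin.zero) + Σℕ D (y m Fin.zero) ≤ s
    endpoints (inj₁ (solution , _)) = subst (_≤ s) (sym (cong₂ _+_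
      (Σℕ-cong D (Sol.start solution)) (Σℕ-cong D λ i → trans (y-end i) (Sol.end solution i))))
      (Σa+Σb≤size a ξ b)
    endpoints (inj₂ (solution , _)) = ℕ.≤-trans (ℕ.≤-reflexive (cong₂ _+_
      (Σℕ-zero D (Sol0.start solution)) (Σℕ-zero D λ i → trans (y-end i) (Sol0.end solution i)))) z≤n

  norm1-bound : ∀ m → Minimal (Sol a ξ b) m ⊎ Minimal (Sol0 a ξ b) m → norm1 m ≤ 2 ^ suc (exponent s)
  norm1-bound m minimal with dimension≤size a ξ b | minimal
  ... | inj₂ (K≡0 , nT≡0) | _ =
    ℕ.≤-trans (degenerate-bound K≡0 nT≡0 minimal)
      (ℕ.≤-trans size≤2^exponent (ℕ.^-monoʳ-≤ 2 (ℕ.n≤1+n (exponent s))))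
  ... | inj₁ D≤s | inj₁ minimal-solution = begin
    norm1 m                          ≤⟨ inhomogeneous-bound Δ⋆ 2Λ≤Δ⋆ rhs-base-bound minimal-solution ⟩
    collision-bound Δ⋆ + norm1 base  ≤⟨ ℕ.+-mono-≤ (collision-bound≤2^exponent D≤s)
                                          (ℕ.≤-trans norm1-base size≤2^exponent) ⟩
    2 ^ exponent s + 2 ^ exponent s  ≡⟨ 2^n+2^n≡2^[1+n] (exponent s) ⟩
    2 ^ suc (exponent s)             ∎
    where open ℕ.≤-Reasoning
  ... | inj₁ D≤s | inj₂ minimal-solution = ℕ.≤-trans (homogeneous-bound Δ⋆ 2Λ≤Δ⋆ minimal-solution)
    (ℕ.≤-trans (collision-bound≤2^exponent D≤s) (ℕ.^-monoʳ-≤ 2 (ℕ.n≤1+n (exponent s))))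

exponent-polynomial : ∀ s → suc (exponent s) ≡ evalPoly (1 ∷ 16 ∷ 52 ∷ 52 ∷ 16 ∷ []) s
exponent-polynomial = solve 1 (λ s →
  con 1 :+ ((con 4 :* Q s :+ con 3 :+ ((con 1 :+ s) :+ (con 1 :+ s))) :* Q s :+ s)
  := con 1 :+ s :* (con 16 :+ s :* (con 52 :+ s :* (con 52 :+ s :* (con 16 :+ s :* con 0))))) refl
  where
  open ℕ-Solver.+-*-Solver
  Q : ∀ {n} → Polynomial n → Polynomial n
  Q s = s :+ (s :* s :+ (s :* s :+ (s :+ s)))

lemma2p4 : Σ (List ℕ) λ P →
    ∀ (D : ℕ) → 1 ≤ D → (ξ : CGS D) (a b : Fin D → ℕ) (m : Assign ξ) →
      (Minimal (Sol a ξ b) m ⊎ Minimal (Sol0 a ξ b) m) →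
      norm1 m ≤ 2 ^ evalPoly P (size a ξ b)
lemma2p4 = 1 ∷ 16 ∷ 52 ∷ 52 ∷ 16 ∷ [] , λ D _ ξ a b m minimal →
  subst (λ e → norm1 m ≤ 2 ^ e) (exponent-polynomial (size a ξ b)) (norm1-bound a ξ b m minimal)
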